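{- Let $m\ge1$ and let $\gamma\in G(\mathbf{Z}_p)$ be any element whose first column is $(1,1,0,0)^T$. Then $H(\mathbf{Q}_p)\cap\gamma\,\mathrm{Kl}(p^m)\,\gamma^{ -1}=K_{H,\Delta}(p^m)$.
   Context: $G=\mathrm{GSp}_4$ is the group scheme of $4\times4$ matrices preserving up to scalar the form with matrix $J$ with rows $(0,0,0,1),(0,0,1,0),(0,-1,0,0),(-1,0,0,0)$. $P_{\mathrm{Kl}}$ is the Klingen parabolic: elements with first column $(*,0,0,0)^T$ and last row $(0,0,0,*)$; $\mathrm{Kl}(p^m)=\{g\in G(\mathbf{Z}_p): g\bmod p^m\in P_{\mathrm{Kl}}\}$. $H=\mathrm{GL}_2\times_{\mathrm{GL}_1}\mathrm{GL}_2$ (pairs with equal determinant) embedded in $G$ by $\big(\begin{smallmatrix}a&b\\c&d\end{smallmatrix},\begin{smallmatrix}a'&b'\\c'&d'\end{smallmatrix}\big)\mapsto$ the matrix with rows $(a,0,0,b),(0,a',b',0),(0,c',d',0),(c,0,0,d)$. $K_{H,\Delta}(p^m)$ is the set of $h\in H(\mathbf{Z}_p)$ with $h\equiv\big(\begin{smallmatrix}x&*\\0&*\end{smallmatrix},\begin{smallmatrix}x&*\\0&*\end{smallmatrix}\big)\pmod{p^m}$ for some $x$. -}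

module Defs where

open import Data.Nat as ℕ using (ℕ; suc)
open import Data.Integer as ℤ using (ℤ; +_; _-_)
open import Data.Integer.Divisibility.Signed using (_∣_; divides; ∣m∣n⇒∣m+n; ∣m⇒∣-m; ∣n⇒∣m*n; ∣m⇒∣m*n)
open import Data.Integer.Properties using (*-zeroˡ)
open import Data.Integer.Solver using (module +-*-Solver)
open import Data.Fin using (Fin; zero; suc)
open import Data.Product using (Σ; ∃; _×_; _,_)
open import Relation.Binary.PropositionalEquality using (_≡_; refl; sym; subst)

open +-*-Solver

-- Z_p = lim Z/p^n : an element is a sequence of integer representatives
-- r n of its residue class modulo p^n, compatible in the sense that
-- r (n+1) ≡ r n (mod p^n).
--
-- Q_p = Z_p[1/p] : a pair (e , a) stands for a / p^e.

module Padic (p : ℕ) where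

  P : ℕ → ℤ
  P n = + (p ℕ.^ n)

  record Zp : Set where
    constructor mkZp
    field
      r   : ℕ → ℤ
      coh : ∀ n → P n ∣ (r (suc n) - r n)
  open Zp public

  infix 4 _≈_ _≈Q_
  infixl 6 _+ᶻ_ _+Q_
  infixl 7 _*ᶻ_ _*Q_ _·ᶻ_ _·Q_
  infix 4 _≈M_ _≈MQ_ _≡_mod[p^_]

  _≈_ : Zp → Zp → Set
  x ≈ y = ∀ n → P n ∣ (r x n - r y n)

  _≡_mod[p^_] : Zp → Zp → ℕ → Set
  x ≡ y mod[p^ m ] = P m ∣ (r x m - r y m)

  private
    const-coh : ∀ (c : ℤ) n → P n ∣ (c - c)
    const-coh c n = subst (P n ∣_)
      (solve 1 (λ c → con (+ 0) := c :- c) refl c)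
      (divides (+ 0) (sym (*-zeroˡ (P n))))

  fromℤ : ℤ → Zp
  fromℤ c = mkZp (λ _ → c) (const-coh c)

  0ᶻ 1ᶻ : Zp
  0ᶻ = fromℤ (+ 0)
  1ᶻ = fromℤ (+ 1)

  _+ᶻ_ : Zp → Zp → Zp
  x +ᶻ y = mkZp (λ n → r x n ℤ.+ r y n) λ n →
    subst (P n ∣_)
      (solve 4 (λ a a' b b' → (a' :- a) :+ (b' :- b) := (a' :+ b') :- (a :+ b)) refl
        (r x n) (r x (suc n)) (r y n) (r y (suc n)))
      (∣m∣n⇒∣m+n (coh x n) (coh y n))

  -ᶻ_ : Zp → Zp
  -ᶻ x = mkZp (λ n → ℤ.- r x n) λ n →
    subst (P n ∣_)
      (solve 2 (λ a a' → :- (a' :- a) := (:- a') :- (:- a)) refl (r x n) (r x (suc n)))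
      (∣m⇒∣-m (coh x n))

  _*ᶻ_ : Zp → Zp → Zp
  x *ᶻ y = mkZp (λ n → r x n ℤ.* r y n) λ n →
    subst (P n ∣_)
      (solve 4 (λ a a' b b' → (a' :* (b' :- b)) :+ ((a' :- a) :* b) := (a' :* b') :- (a :* b)) refl
        (r x n) (r x (suc n)) (r y n) (r y (suc n)))
      (∣m∣n⇒∣m+n (∣n⇒∣m*n (r x (suc n)) (coh y n)) (∣m⇒∣m*n (r y n) (coh x n)))

  UnitZ : Zp → Set
  UnitZ x = ∃ λ y → x *ᶻ y ≈ 1ᶻ

  pw : ℕ → Zp
  pw k = fromℤ (P k)

  record Qp : Set where
    constructor _/p^_
    field
      num : Zp
      ex  : ℕ
  open Qp public

  _≈Q_ : Qp → Qp → Set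
  (a /p^ e) ≈Q (b /p^ f) = a *ᶻ pw f ≈ b *ᶻ pw e

  ι : Zp → Qp
  ι a = a /p^ 0

  0Q 1Q : Qp
  0Q = ι 0ᶻ
  1Q = ι 1ᶻ

  _+Q_ : Qp → Qp → Qp
  (a /p^ e) +Q (b /p^ f) = (a *ᶻ pw f +ᶻ b *ᶻ pw e) /p^ (e ℕ.+ f)

  -Q_ : Qp → Qp
  -Q (a /p^ e) = (-ᶻ a) /p^ e

  _*Q_ : Qp → Qp → Qp
  (a /p^ e) *Q (b /p^ f) = (a *ᶻ b) /p^ (e ℕ.+ f)

  UnitQ : Qp → Set
  UnitQ x = ∃ λ y → x *Q y ≈Q 1Q

  -- Matrices (indices 0..n-1; entry g i j is row i, column j)

  Mat : ℕ → Set → Set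
  Mat n A = Fin n → Fin n → A

  f0 f1 f2 f3 : Fin 4
  f0 = zero
  f1 = suc zero
  f2 = suc (suc zero)
  f3 = suc (suc (suc zero))

  _·ᶻ_ : Mat 4 Zp → Mat 4 Zp → Mat 4 Zp
  (g ·ᶻ h) i j = g i f0 *ᶻ h f0 j +ᶻ g i f1 *ᶻ h f1 j +ᶻ g i f2 *ᶻ h f2 j +ᶻ g i f3 *ᶻ h f3 j

  _·Q_ : Mat 4 Qp → Mat 4 Qp → Mat 4 Qp
  (g ·Q h) i j = g i f0 *Q h f0 j +Q g i f1 *Q h f1 j +Q g i f2 *Q h f2 j +Q g i f3 *Q h f3 j

  transpose : Mat 4 Zp → Mat 4 Zp
  transpose g i j = g j i

  _≈M_ : Mat 4 Zp → Mat 4 Zp → Set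
  g ≈M h = ∀ i j → g i j ≈ h i j

  _≈MQ_ : Mat 4 Qp → Mat 4 Qp → Set
  g ≈MQ h = ∀ i j → g i j ≈Q h i j

  ιM : Mat 4 Zp → Mat 4 Qp
  ιM g i j = ι (g i j)

  J : Mat 4 Zp
  J zero (suc (suc (suc zero)))       = 1ᶻ
  J (suc zero) (suc (suc zero))       = 1ᶻ
  J (suc (suc zero)) (suc zero)       = -ᶻ 1ᶻ
  J (suc (suc (suc zero))) zero       = -ᶻ 1ᶻ
  J _ _ = 0ᶻ

  scal : Zp → Mat 4 Zp → Mat 4 Zp
  scal c g i j = c *ᶻ g i j

  InGZp : Mat 4 Zp → Set
  InGZp g = ∃ λ ν → UnitZ ν × ((transpose g ·ᶻ J) ·ᶻ g ≈M scal ν J)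

  -- Kl(p^m): g ∈ G(Z_p) with g mod p^m in the Klingen parabolic,
  -- i.e. first column (*,0,0,0)^T and last row (0,0,0,*) mod p^m
  InKl : ℕ → Mat 4 Zp → Set
  InKl m g = InGZp g
           × (g f1 f0 ≡ 0ᶻ mod[p^ m ]) × (g f2 f0 ≡ 0ᶻ mod[p^ m ]) × (g f3 f0 ≡ 0ᶻ mod[p^ m ])
           × (g f3 f1 ≡ 0ᶻ mod[p^ m ]) × (g f3 f2 ≡ 0ᶻ mod[p^ m ])

  det2ᶻ : Mat 2 Zp → Zp
  det2ᶻ A = A zero zero *ᶻ A (suc zero) (suc zero) +ᶻ -ᶻ (A zero (suc zero) *ᶻ A (suc zero) zero)

  det2Q : Mat 2 Qp → Qp
  det2Q A = A zero zero *Q A (suc zero) (suc zero) +Q -Q (A zero (suc zero) *Q A (suc zero) zero)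

  InHQp : Mat 2 Qp → Mat 2 Qp → Set
  InHQp A A' = UnitQ (det2Q A) × (det2Q A ≈Q det2Q A')

  InHZp : Mat 2 Zp → Mat 2 Zp → Set
  InHZp B B' = UnitZ (det2ᶻ B) × (det2ᶻ B ≈ det2ᶻ B')

  embH : Mat 2 Qp → Mat 2 Qp → Mat 4 Qp
  embH A A' zero zero                                 = A zero zero
  embH A A' zero (suc (suc (suc zero)))               = A zero (suc zero)
  embH A A' (suc (suc (suc zero))) zero               = A (suc zero) zero
  embH A A' (suc (suc (suc zero))) (suc (suc (suc zero))) = A (suc zero) (suc zero)
  embH A A' (suc zero) (suc zero)                     = A' zero zero
  embH A A' (suc zero) (suc (suc zero))               = A' zero (suc zero)
  embH A A' (suc (suc zero)) (suc zero)               = A' (suc zero) zero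
  embH A A' (suc (suc zero)) (suc (suc zero))         = A' (suc zero) (suc zero)
  embH A A' _ _ = 0Q

  InKHΔ : ℕ → Mat 2 Zp → Mat 2 Zp → Set
  InKHΔ m B B' = InHZp B B'
               × (∃ λ x → (B zero zero ≡ x mod[p^ m ]) × (B' zero zero ≡ x mod[p^ m ]))
               × (B (suc zero) zero ≡ 0ᶻ mod[p^ m ]) × (B' (suc zero) zero ≡ 0ᶻ mod[p^ m ])

  InKHΔQ : ℕ → Mat 2 Qp → Mat 2 Qp → Set
  InKHΔQ m A A' = Σ (Mat 2 Zp) λ B → Σ (Mat 2 Zp) λ B' →
      InKHΔ m B B' × (∀ i j → A i j ≈Q ι (B i j)) × (∀ i j → A' i j ≈Q ι (B' i j))

  -- the image of (A,A') in G(Q_p) lies in γ Kl(p^m) γ^{-1},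
  -- i.e. embH A A' = γ k γ^{-1} for some k ∈ Kl(p^m), written as embH A A' · γ = γ · k
  InConjKl : ℕ → Mat 4 Zp → Mat 2 Qp → Mat 2 Qp → Set
  InConjKl m γ A A' = Σ (Mat 4 Zp) λ k → InKl m k × ((embH A A' ·Q ιM γ) ≈MQ (ιM γ ·Q ιM k))

-- If k ∈ Kl(pᵐ) and h = embed(A, A′) satisfy h γ = γ k, then h = γ k γ⁻¹ is integral (γ⁻¹ is integral
-- because det γ = Pf(γᵀJγ) = ν² is a unit), and its two blocks B, B′ are integral with det B = det B′
-- equal to the multiplier of k.  Reading h γ = γ k modulo pᵐ in the first column, where γ has
-- (1,1,0,0)ᵀ and k has (x,0,0,0)ᵀ, gives B₀₀ ≡ B′₀₀ ≡ x and B₁₀ ≡ B′₁₀ ≡ 0.  Conversely, for (B, B′) in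
-- K_{H,Δ}(pᵐ), k = γ⁻¹ embed(B, B′) γ is an integral similitude whose first column is ≡ (x,0,0,0)ᵀ by
-- the same computation; the first row of kᵀJk = det B · J then says k₀₀ k₃ⱼ ≡ det B · δ₃ⱼ, so k₀₀ is a
-- unit mod pᵐ and k₃₁ ≡ k₃₂ ≡ 0.
module Submission where

open import Algebra.Bundles using (CommutativeRing; RawRing)
open import Algebra.Consequences.Setoid using (comm∧distrˡ⇒distrʳ)
import Algebra.Construct.Pointwise as Pointwise
open import Algebra.Morphism.Structures using (IsRingHomomorphism; IsRingMonomorphism)
import Algebra.Morphism.RingMonomorphism as RingMonomorphism
open import Algebra.Solver.Ring.AlmostCommutativeRing using (_-Raw-AlmostCommutative⟶_; fromCommutativeRing)
open import Data.Fin as Fin using (Fin; zero; suc; punchIn; toℕ)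
open import Data.Fin.Patterns using (0F; 1F; 2F; 3F)
open import Data.Integer as ℤ using (ℤ; +_; -[1+_]; _⊖_)
open import Data.Integer.Divisibility.Signed using (_∣_; divides; ∣-trans; ∣m∣n⇒∣m+n; ∣m⇒∣-m; ∣n⇒∣m*n; ∣m⇒∣m*n; *-cancelʳ-∣)
import Data.Integer.Properties as ℤ
open import Data.Integer.Tactic.RingSolver using (solve-∀; solve)
open import Data.List using ([]; _∷_)
open import Data.Maybe using (Maybe; just; nothing)
open import Data.Nat as ℕ using (ℕ; zero; suc; NonZero; _≤_)
import Data.Nat.Properties as ℕ
open import Data.Nat.Primality using (Prime; prime⇒nonZero)
open import Data.Product using (Σ; ∃; _×_; _,_; uncurry)
open import Data.Sign as Sign using (Sign)
open import Data.Vec using (Vec; tabulate; _++_; [_])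
open import Function.Bundles using (_⇔_; mk⇔)
open import Level using (Level; 0ℓ; _⊔_)
open import Relation.Binary.Bundles using (Setoid)
open import Relation.Binary.Core using (Rel)
open import Relation.Binary.PropositionalEquality as ≡ using (_≡_)
import Relation.Binary.Reasoning.Setoid
open import Relation.Binary.Structures using (IsEquivalence)
open import Relation.Nullary using (yes; no)
open import Defs

module FromInteger {c ℓ : Level} (R : CommutativeRing c ℓ) where
  open CommutativeRing R
  open import Algebra.Properties.Ring ring using (-‿involutive; -‿distribˡ-*; -‿distribʳ-*; -‿+-comm; -0#≈0#)
  open import Relation.Binary.Reasoning.Setoid setoid

  -- fromℕ 1 is 1# itself, so the solver's constants 0 and 1 evaluate to 0# and 1# on the nose.
  fromℕ : ℕ → Carrier
  fromℕ zero          = 0#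
  fromℕ (suc zero)    = 1#
  fromℕ (suc (suc n)) = 1# + fromℕ (suc n)

  fromℤ : ℤ → Carrier
  fromℤ (+ n)      = fromℕ n
  fromℤ -[1+ n ]   = - fromℕ (suc n)

  fromℕ-suc : ∀ n → fromℕ (suc n) ≈ 1# + fromℕ n
  fromℕ-suc zero    = sym (+-identityʳ 1#)
  fromℕ-suc (suc n) = refl

  fromℕ-+ : ∀ m n → fromℕ (m ℕ.+ n) ≈ fromℕ m + fromℕ n
  fromℕ-+ zero    n = sym (+-identityˡ _)
  fromℕ-+ (suc m) n = begin
    fromℕ (suc (m ℕ.+ n))    ≈⟨ fromℕ-suc (m ℕ.+ n) ⟩
    1# + fromℕ (m ℕ.+ n)     ≈⟨ +-congˡ (fromℕ-+ m n) ⟩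
    1# + (fromℕ m + fromℕ n) ≈⟨ +-assoc 1# _ _ ⟨
    1# + fromℕ m + fromℕ n   ≈⟨ +-congʳ (fromℕ-suc m) ⟨
    fromℕ (suc m) + fromℕ n  ∎

  fromℕ-* : ∀ m n → fromℕ (m ℕ.* n) ≈ fromℕ m * fromℕ n
  fromℕ-* zero    n = sym (zeroˡ _)
  fromℕ-* (suc m) n = begin
    fromℕ (n ℕ.+ m ℕ.* n)           ≈⟨ fromℕ-+ n (m ℕ.* n) ⟩
    fromℕ n + fromℕ (m ℕ.* n)       ≈⟨ +-cong (sym (*-identityˡ _)) (fromℕ-* m n) ⟩
    1# * fromℕ n + fromℕ m * fromℕ n ≈⟨ distribʳ _ _ _ ⟨
    (1# + fromℕ m) * fromℕ n        ≈⟨ *-congʳ (fromℕ-suc m) ⟨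
    fromℕ (suc m) * fromℕ n         ∎

  fromℤ-⊖ : ∀ m n → fromℤ (m ⊖ n) ≈ fromℕ m - fromℕ n
  fromℤ-⊖ zero    zero    = sym (-‿inverseʳ 0#)
  fromℤ-⊖ zero    (suc n) = sym (+-identityˡ _)
  fromℤ-⊖ (suc m) zero    = sym (trans (+-congˡ -0#≈0#) (+-identityʳ _))
  fromℤ-⊖ (suc m) (suc n) = begin
    fromℤ (suc m ⊖ suc n)               ≡⟨ ≡.cong fromℤ (ℤ.[1+m]⊖[1+n]≡m⊖n m n) ⟩
    fromℤ (m ⊖ n)                       ≈⟨ fromℤ-⊖ m n ⟩
    fromℕ m - fromℕ n                   ≈⟨ cancel 1# (fromℕ m) (fromℕ n) ⟨
    (1# + fromℕ m) - (1# + fromℕ n)     ≈⟨ +-cong (fromℕ-suc m) (-‿cong (fromℕ-suc n)) ⟨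
    fromℕ (suc m) - fromℕ (suc n)       ∎
    where
    cancel : ∀ a b c → (a + b) - (a + c) ≈ b - c
    cancel a b c = begin
      (a + b) - (a + c)     ≈⟨ +-cong (+-comm b a) (-‿+-comm a c) ⟨
      (b + a) + (- a - c)   ≈⟨ +-assoc b a _ ⟩
      b + (a + (- a - c))   ≈⟨ +-congˡ (+-assoc a (- a) (- c)) ⟨
      b + ((a - a) - c)     ≈⟨ +-congˡ (+-congʳ (-‿inverseʳ a)) ⟩
      b + (0# - c)          ≈⟨ +-congˡ (+-identityˡ (- c)) ⟩
      b - c                 ∎

  fromℤ-+ : ∀ i j → fromℤ (i ℤ.+ j) ≈ fromℤ i + fromℤ j
  fromℤ-+ -[1+ m ] -[1+ n ] = begin
    - fromℕ (suc (suc (m ℕ.+ n)))     ≡⟨ ≡.cong (λ k → - fromℕ (suc k)) (ℕ.+-suc m n) ⟨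
    - fromℕ (suc m ℕ.+ suc n)         ≈⟨ -‿cong (fromℕ-+ (suc m) (suc n)) ⟩
    - (fromℕ (suc m) + fromℕ (suc n)) ≈⟨ -‿+-comm _ _ ⟨
    - fromℕ (suc m) - fromℕ (suc n)   ∎
  fromℤ-+ -[1+ m ] (+ n)    = trans (fromℤ-⊖ n (suc m)) (+-comm _ _)
  fromℤ-+ (+ m)    -[1+ n ] = fromℤ-⊖ m (suc n)
  fromℤ-+ (+ m)    (+ n)    = fromℕ-+ m n

  fromℤ-neg : ∀ i → fromℤ (ℤ.- i) ≈ - fromℤ i
  fromℤ-neg (+ zero)  = sym -0#≈0#
  fromℤ-neg (+ suc n) = refl
  fromℤ-neg -[1+ n ]  = sym (-‿involutive _)

  signed : Sign → Carrier → Carrier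
  signed Sign.+ x = x
  signed Sign.- x = - x

  fromℤ-◃ : ∀ s n → fromℤ (s ℤ.◃ n) ≈ signed s (fromℕ n)
  fromℤ-◃ Sign.+ zero    = refl
  fromℤ-◃ Sign.- zero    = sym -0#≈0#
  fromℤ-◃ Sign.+ (suc n) = refl
  fromℤ-◃ Sign.- (suc n) = refl

  fromℤ-signAbs : ∀ i → fromℤ i ≈ signed (ℤ.sign i) (fromℕ ℤ.∣ i ∣)
  fromℤ-signAbs (+ n)    = refl
  fromℤ-signAbs -[1+ n ] = refl

  signed-cong : ∀ s {x y} → x ≈ y → signed s x ≈ signed s y
  signed-cong Sign.+ x≈y = x≈y
  signed-cong Sign.- x≈y = -‿cong x≈y

  signed-* : ∀ s t x y → signed (s Sign.* t) (x * y) ≈ signed s x * signed t y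
  signed-* Sign.+ Sign.+ x y = refl
  signed-* Sign.+ Sign.- x y = -‿distribʳ-* x y
  signed-* Sign.- Sign.+ x y = -‿distribˡ-* x y
  signed-* Sign.- Sign.- x y = begin
    x * y         ≈⟨ -‿involutive _ ⟨
    - - (x * y)   ≈⟨ -‿cong (-‿distribʳ-* x y) ⟩
    - (x * - y)   ≈⟨ -‿distribˡ-* x (- y) ⟩
    - x * - y     ∎

  fromℤ-* : ∀ i j → fromℤ (i ℤ.* j) ≈ fromℤ i * fromℤ j
  fromℤ-* i j = begin
    fromℤ (s ℤ.◃ ℤ.∣ i ∣ ℕ.* ℤ.∣ j ∣)           ≈⟨ fromℤ-◃ s (ℤ.∣ i ∣ ℕ.* ℤ.∣ j ∣) ⟩
    signed s (fromℕ (ℤ.∣ i ∣ ℕ.* ℤ.∣ j ∣))       ≈⟨ signed-cong s (fromℕ-* ℤ.∣ i ∣ ℤ.∣ j ∣) ⟩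
    signed s (fromℕ ℤ.∣ i ∣ * fromℕ ℤ.∣ j ∣)     ≈⟨ signed-* (ℤ.sign i) (ℤ.sign j) _ _ ⟩
    signed (ℤ.sign i) (fromℕ ℤ.∣ i ∣) * signed (ℤ.sign j) (fromℕ ℤ.∣ j ∣)
                                                ≈⟨ *-cong (fromℤ-signAbs i) (fromℤ-signAbs j) ⟨
    fromℤ i * fromℤ j                           ∎
    where s = ℤ.sign i Sign.* ℤ.sign j

  homomorphism : ℤ.+-*-rawRing -Raw-AlmostCommutative⟶ fromCommutativeRing R
  homomorphism = record
    { ⟦_⟧ = fromℤ ; +-homo = fromℤ-+ ; *-homo = fromℤ-* ; -‿homo = fromℤ-neg ; 0-homo = refl ; 1-homo = refl }

  coefficient≟ : ∀ a b → Maybe (fromℤ a ≈ fromℤ b)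
  coefficient≟ a b with a ℤ.≟ b
  ... | yes ≡.refl = just refl
  ... | no _       = nothing

∣-resp-≡ : ∀ {k a b} → a ≡ b → k ∣ a → k ∣ b
∣-resp-≡ = ≡.subst (_ ∣_)

a≡b⇒k∣a-b : ∀ {k a b} → a ≡ b → k ∣ a ℤ.- b
a≡b⇒k∣a-b {k} {a} ≡.refl = ∣-resp-≡ (lemma a) (divides (+ 0) (≡.sym (ℤ.*-zeroˡ k)))
  where lemma : ∀ a → + 0 ≡ a ℤ.- a
        lemma = solve-∀

module _ {c ℓ ℓ′ : Level} (R : CommutativeRing c ℓ) where
  open CommutativeRing R

  quotientRing : (_∼_ : Rel Carrier ℓ′) → IsEquivalence _∼_ → (∀ {x y} → x ≈ y → x ∼ y) →
                 (∀ {x y u v} → x ∼ y → u ∼ v → (x + u) ∼ (y + v)) →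
                 (∀ {x y u v} → x ∼ y → u ∼ v → (x * u) ∼ (y * v)) →
                 (∀ {x y} → x ∼ y → (- x) ∼ (- y)) →
                 CommutativeRing c ℓ′
  quotientRing _∼_ isEquivalence ≈⇒∼ +-cong∼ *-cong∼ -‿cong∼ = record
    { Carrier = Carrier ; _≈_ = _∼_ ; _+_ = _+_ ; _*_ = _*_ ; -_ = -_ ; 0# = 0# ; 1# = 1#
    ; isCommutativeRing = record
      { isRing = record
        { +-isAbelianGroup = record
          { isGroup = record
            { isMonoid = record
              { isSemigroup = record
                { isMagma = record { isEquivalence = isEquivalence ; ∙-cong = +-cong∼ }
                ; assoc = λ x y z → ≈⇒∼ (+-assoc x y z) }
              ; identity = (λ x → ≈⇒∼ (+-identityˡ x)) , (λ x → ≈⇒∼ (+-identityʳ x)) }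
            ; inverse = (λ x → ≈⇒∼ (-‿inverseˡ x)) , (λ x → ≈⇒∼ (-‿inverseʳ x))
            ; ⁻¹-cong = -‿cong∼ }
          ; comm = λ x y → ≈⇒∼ (+-comm x y) }
        ; *-cong = *-cong∼
        ; *-assoc = λ x y z → ≈⇒∼ (*-assoc x y z)
        ; *-identity = (λ x → ≈⇒∼ (*-identityˡ x)) , (λ x → ≈⇒∼ (*-identityʳ x))
        ; distrib = (λ x y z → ≈⇒∼ (distribˡ x y z)) , (λ x y z → ≈⇒∼ (distribʳ x y z)) }
      ; *-comm = λ x y → ≈⇒∼ (*-comm x y) } }

module IntegersModulo (k : ℤ) where
  open import Data.Integer using (_-_)

  infix 4 _≈ₖ_
  _≈ₖ_ : Rel ℤ 0ℓ
  a ≈ₖ b = k ∣ a - b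

  ≈ₖ-refl : ∀ {a} → a ≈ₖ a
  ≈ₖ-refl {a} = a≡b⇒k∣a-b {k} {a} ≡.refl

  ≈ₖ-sym : ∀ {a b} → a ≈ₖ b → b ≈ₖ a
  ≈ₖ-sym {a} {b} a≈b = ∣-resp-≡ (lemma a b) (∣m⇒∣-m a≈b)
    where lemma : ∀ a b → ℤ.- (a - b) ≡ b - a
          lemma = solve-∀

  ≈ₖ-trans : ∀ {a b c} → a ≈ₖ b → b ≈ₖ c → a ≈ₖ c
  ≈ₖ-trans {a} {b} {c} a≈b b≈c = ∣-resp-≡ (lemma a b c) (∣m∣n⇒∣m+n a≈b b≈c)
    where lemma : ∀ a b c → (a - b) ℤ.+ (b - c) ≡ a - c
          lemma = solve-∀

  isEquivalence : IsEquivalence _≈ₖ_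
  isEquivalence = record
    { refl = λ {a} → ≈ₖ-refl {a} ; sym = λ {a} {b} → ≈ₖ-sym {a} {b} ; trans = λ {a} {b} {c} → ≈ₖ-trans {a} {b} {c} }

  +-cong : ∀ {a b c d} → a ≈ₖ b → c ≈ₖ d → a ℤ.+ c ≈ₖ b ℤ.+ d
  +-cong {a} {b} {c} {d} a≈b c≈d = ∣-resp-≡ (lemma a b c d) (∣m∣n⇒∣m+n a≈b c≈d)
    where lemma : ∀ a b c d → (a - b) ℤ.+ (c - d) ≡ (a ℤ.+ c) - (b ℤ.+ d)
          lemma = solve-∀

  *-cong : ∀ {a b c d} → a ≈ₖ b → c ≈ₖ d → a ℤ.* c ≈ₖ b ℤ.* d
  *-cong {a} {b} {c} {d} a≈b c≈d = ∣-resp-≡ (lemma a b c d) (∣m∣n⇒∣m+n (∣m⇒∣m*n c a≈b) (∣n⇒∣m*n b c≈d))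
    where lemma : ∀ a b c d → (a - b) ℤ.* c ℤ.+ b ℤ.* (c - d) ≡ a ℤ.* c - b ℤ.* d
          lemma = solve-∀

  -‿cong : ∀ {a b} → a ≈ₖ b → ℤ.- a ≈ₖ ℤ.- b
  -‿cong {a} {b} a≈b = ∣-resp-≡ (lemma a b) (∣m⇒∣-m a≈b)
    where lemma : ∀ a b → ℤ.- (a - b) ≡ ℤ.- a - ℤ.- b
          lemma = solve-∀

  commutativeRing : CommutativeRing 0ℓ 0ℓ
  commutativeRing = quotientRing ℤ.+-*-commutativeRing _≈ₖ_ isEquivalence (λ {a} {b} → a≡b⇒k∣a-b {k} {a} {b})
    (λ {a} {b} {c} {d} → +-cong {a} {b} {c} {d}) (λ {a} {b} {c} {d} → *-cong {a} {b} {c} {d})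
    (λ {a} {b} → -‿cong {a} {b})

module PadicIntegers (p : ℕ) where
  open Padic p
  open import Data.Integer using (_-_)
  module AtLevel n = IntegersModulo (P n)

  -- ℤₚ is the subring of coherent sequences in ∏ₙ ℤ/pⁿ; its ring laws are pulled back along r.
  ∏ℤ/pⁿ : CommutativeRing 0ℓ 0ℓ
  ∏ℤ/pⁿ = quotientRing (Pointwise.commutativeRing ℕ ℤ.+-*-commutativeRing) _∼_ isEquivalence
    (λ f≡g n → a≡b⇒k∣a-b (f≡g n))
    (λ {f} {g} {u} {v} f∼g u∼v n → AtLevel.+-cong n {f n} {g n} {u n} {v n} (f∼g n) (u∼v n))
    (λ {f} {g} {u} {v} f∼g u∼v n → AtLevel.*-cong n {f n} {g n} {u n} {v n} (f∼g n) (u∼v n))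
    (λ {f} {g} f∼g n → AtLevel.-‿cong n {f n} {g n} (f∼g n))
    where
    _∼_ : Rel (ℕ → ℤ) 0ℓ
    f ∼ g = ∀ n → P n ∣ (f n - g n)
    isEquivalence : IsEquivalence _∼_
    isEquivalence = record
      { refl = λ {f} n → AtLevel.≈ₖ-refl n {f n}
      ; sym = λ {f} {g} f∼g n → AtLevel.≈ₖ-sym n {f n} {g n} (f∼g n)
      ; trans = λ {f} {g} {h} f∼g g∼h n → AtLevel.≈ₖ-trans n {f n} {g n} {h n} (f∼g n) (g∼h n) }

  ℤₚ-rawRing : RawRing 0ℓ 0ℓ
  ℤₚ-rawRing = record { Carrier = Zp ; _≈_ = _≈_ ; _+_ = _+ᶻ_ ; _*_ = _*ᶻ_ ; -_ = -ᶻ_ ; 0# = 0ᶻ ; 1# = 1ᶻ }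

  residues-isRingMonomorphism : IsRingMonomorphism ℤₚ-rawRing (CommutativeRing.rawRing ∏ℤ/pⁿ) r
  residues-isRingMonomorphism = record
    { isRingHomomorphism = record
      { isSemiringHomomorphism = record
        { isNearSemiringHomomorphism = record
          { +-isMonoidHomomorphism = record
            { isMagmaHomomorphism = record
              { isRelHomomorphism = record { cong = λ x≈y → x≈y } ; homo = λ x y → same (x +ᶻ y) }
            ; ε-homo = same 0ᶻ }
          ; *-homo = λ x y → same (x *ᶻ y) }
        ; 1#-homo = same 1ᶻ }
      ; -‿homo = λ x → same (-ᶻ x) }
    ; injective = λ x≈y → x≈y }
    where
    same : ∀ x → x ≈ x
    same x n = AtLevel.≈ₖ-refl n {r x n}

  ℤₚ : CommutativeRing 0ℓ 0ℓ
  ℤₚ = record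
    { isCommutativeRing = RingMonomorphism.isCommutativeRing residues-isRingMonomorphism
                            (CommutativeRing.isCommutativeRing ∏ℤ/pⁿ) }

module PadicNumbers (p : ℕ) .{{_ : NonZero p}} where
  open Padic p
  open PadicIntegers p
  open import Data.Integer using (_+_; _*_; -_; _-_)

  P-+ : ∀ e f → P (e ℕ.+ f) ≡ P e * P f
  P-+ e f = ≡.trans (≡.cong +_ (ℕ.^-distribˡ-+-* p e f)) (ℤ.pos-* (p ℕ.^ e) (p ℕ.^ f))

  residue-coherent : ∀ x n k → P n ∣ (r x (n ℕ.+ k) - r x n)
  residue-coherent x n ℕ.zero = ≡.subst (λ i → P n ∣ (r x i - r x n)) (≡.sym (ℕ.+-identityʳ n)) (AtLevel.≈ₖ-refl n {r x n})
  residue-coherent x n (suc k) = ≡.subst (λ i → P n ∣ (r x i - r x n)) (≡.sym (ℕ.+-suc n k))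
    (AtLevel.≈ₖ-trans n {r x (suc (n ℕ.+ k))} {r x (n ℕ.+ k)} {r x n}
      (∣-trans (divides (P k) (≡.trans (P-+ n k) (ℤ.*-comm (P n) (P k)))) (coh x (n ℕ.+ k)))
      (residue-coherent x n k))

  *-pw-cancelʳ : ∀ x y k → x *ᶻ pw k ≈ y *ᶻ pw k → x ≈ y
  *-pw-cancelʳ x y k eq n = AtLevel.≈ₖ-trans n {r x n} {r x (n ℕ.+ k)} {r y n}
    (AtLevel.≈ₖ-sym n {r x (n ℕ.+ k)} {r x n} (residue-coherent x n k))
    (AtLevel.≈ₖ-trans n {r x (n ℕ.+ k)} {r y (n ℕ.+ k)} {r y n} at-n (residue-coherent y n k))
    where
    instance
      _ : ℤ.NonZero (P k)
      _ = ℕ.m^n≢0 p k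
    at-n : P n ∣ (r x (n ℕ.+ k) - r y (n ℕ.+ k))
    at-n = *-cancelʳ-∣ (P k) (≡.subst₂ _∣_ (P-+ n k) (lemma (r x (n ℕ.+ k)) (r y (n ℕ.+ k)) (P k)) (eq (n ℕ.+ k)))
      where lemma : ∀ a b c → a * c - b * c ≡ (a - b) * c
            lemma = solve-∀

  ≈Q-refl : ∀ {x} → x ≈Q x
  ≈Q-refl {a /p^ e} n = a≡b⇒k∣a-b {a = r a n * P e} ≡.refl

  ≈Q-sym : ∀ {x y} → x ≈Q y → y ≈Q x
  ≈Q-sym {a /p^ e} {b /p^ f} x≈y n = AtLevel.≈ₖ-sym n {r a n * P f} {r b n * P e} (x≈y n)

  ≈Q-trans : ∀ {x y z} → x ≈Q y → y ≈Q z → x ≈Q z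
  ≈Q-trans {a /p^ e} {b /p^ f} {c /p^ g} x≈y y≈z = *-pw-cancelʳ (a *ᶻ pw g) (c *ᶻ pw e) f λ n →
    ∣-resp-≡ (lemma (r a n) (r b n) (r c n) (P e) (P f) (P g))
             (∣m∣n⇒∣m+n (∣m⇒∣m*n (P g) (x≈y n)) (∣m⇒∣m*n (P e) (y≈z n)))
    where lemma : ∀ A B C Pe Pf Pg → (A * Pf - B * Pe) * Pg + (B * Pg - C * Pf) * Pe ≡ A * Pg * Pf - C * Pe * Pf
          lemma = solve-∀

  -- P (e + f) does not reduce to P e * P f, so the laws below abstract the powers in an integer
  -- identity and take the needed instances of P-+ as hypotheses.
  +Q-cong : ∀ {x x′ y y′} → x ≈Q x′ → y ≈Q y′ → (x +Q y) ≈Q (x′ +Q y′)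
  +Q-cong {a /p^ e} {a′ /p^ e′} {b /p^ f} {b′ /p^ f′} x≈x′ y≈y′ n =
    ∣-resp-≡ (lemma (r a n) (r a′ n) (r b n) (r b′ n) (P e) (P e′) (P f) (P f′) (P-+ e′ f′) (P-+ e f))
             (∣m∣n⇒∣m+n (∣m⇒∣m*n (P f * P f′) (x≈x′ n)) (∣m⇒∣m*n (P e * P e′) (y≈y′ n)))
    where
    lemma : ∀ A A′ B B′ Pe Pe′ Pf Pf′ {Pe′f′ Pef} → Pe′f′ ≡ Pe′ * Pf′ → Pef ≡ Pe * Pf →
            (A * Pe′ - A′ * Pe) * (Pf * Pf′) + (B * Pf′ - B′ * Pf) * (Pe * Pe′)
            ≡ (A * Pf + B * Pe) * Pe′f′ - (A′ * Pf′ + B′ * Pe′) * Pef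
    lemma A A′ B B′ Pe Pe′ Pf Pf′ ≡.refl ≡.refl = solve (A ∷ A′ ∷ B ∷ B′ ∷ Pe ∷ Pe′ ∷ Pf ∷ Pf′ ∷ [])

  *Q-cong : ∀ {x x′ y y′} → x ≈Q x′ → y ≈Q y′ → (x *Q y) ≈Q (x′ *Q y′)
  *Q-cong {a /p^ e} {a′ /p^ e′} {b /p^ f} {b′ /p^ f′} x≈x′ y≈y′ n =
    ∣-resp-≡ (lemma (r a n) (r a′ n) (r b n) (r b′ n) (P e) (P e′) (P f) (P f′) (P-+ e′ f′) (P-+ e f))
             (∣m∣n⇒∣m+n (∣m⇒∣m*n (r b n * P f′) (x≈x′ n)) (∣m⇒∣m*n (r a′ n * P e) (y≈y′ n)))
    where
    lemma : ∀ A A′ B B′ Pe Pe′ Pf Pf′ {Pe′f′ Pef} → Pe′f′ ≡ Pe′ * Pf′ → Pef ≡ Pe * Pf →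
            (A * Pe′ - A′ * Pe) * (B * Pf′) + (B * Pf′ - B′ * Pf) * (A′ * Pe)
            ≡ (A * B) * Pe′f′ - (A′ * B′) * Pef
    lemma A A′ B B′ Pe Pe′ Pf Pf′ ≡.refl ≡.refl = solve (A ∷ A′ ∷ B ∷ B′ ∷ Pe ∷ Pe′ ∷ Pf ∷ Pf′ ∷ [])

  -Q-cong : ∀ {x y} → x ≈Q y → (-Q x) ≈Q (-Q y)
  -Q-cong {a /p^ e} {b /p^ f} x≈y n = ∣-resp-≡ (lemma (r a n) (r b n) (P e) (P f)) (∣m⇒∣-m (x≈y n))
    where lemma : ∀ A B Pe Pf → - (A * Pf - B * Pe) ≡ (- A) * Pf - (- B) * Pe
          lemma = solve-∀

  +Q-assoc : ∀ x y z → ((x +Q y) +Q z) ≈Q (x +Q (y +Q z))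
  +Q-assoc (a /p^ e) (b /p^ f) (c /p^ g) n =
    a≡b⇒k∣a-b (lemma (r a n) (r b n) (r c n) (P e) (P f) (P g) (P-+ e f) (P-+ f g) (P-+ e (f ℕ.+ g)) (P-+ (e ℕ.+ f) g))
    where
    lemma : ∀ A B C Pe Pf Pg {Pef Pfg Pe[fg] P[ef]g} → Pef ≡ Pe * Pf → Pfg ≡ Pf * Pg →
            Pe[fg] ≡ Pe * Pfg → P[ef]g ≡ Pef * Pg →
            ((A * Pf + B * Pe) * Pg + C * Pef) * Pe[fg] ≡ (A * Pfg + (B * Pg + C * Pf) * Pe) * P[ef]g
    lemma A B C Pe Pf Pg ≡.refl ≡.refl ≡.refl ≡.refl = solve (A ∷ B ∷ C ∷ Pe ∷ Pf ∷ Pg ∷ [])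

  +Q-identityˡ : ∀ x → (0Q +Q x) ≈Q x
  +Q-identityˡ (a /p^ e) n = a≡b⇒k∣a-b (lemma (r a n) (P e))
    where lemma : ∀ A Pe → (+ 0 * Pe + A * + 1) * Pe ≡ A * Pe
          lemma = solve-∀

  +Q-identityʳ : ∀ x → (x +Q 0Q) ≈Q x
  +Q-identityʳ (a /p^ e) n = a≡b⇒k∣a-b (lemma (r a n) (P e) (P-+ e 0))
    where
    lemma : ∀ A Pe {Pe0} → Pe0 ≡ Pe * + 1 → (A * + 1 + + 0 * Pe) * Pe ≡ A * Pe0
    lemma A Pe ≡.refl = solve (A ∷ Pe ∷ [])

  -Q-inverseˡ : ∀ x → ((-Q x) +Q x) ≈Q 0Q
  -Q-inverseˡ (a /p^ e) n = a≡b⇒k∣a-b (lemma (r a n) (P e) (P (e ℕ.+ e)))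
    where lemma : ∀ A Pe Q → ((- A) * Pe + A * Pe) * + 1 ≡ + 0 * Q
          lemma = solve-∀

  -Q-inverseʳ : ∀ x → (x +Q (-Q x)) ≈Q 0Q
  -Q-inverseʳ (a /p^ e) n = a≡b⇒k∣a-b (lemma (r a n) (P e) (P (e ℕ.+ e)))
    where lemma : ∀ A Pe Q → (A * Pe + (- A) * Pe) * + 1 ≡ + 0 * Q
          lemma = solve-∀

  +Q-comm : ∀ x y → (x +Q y) ≈Q (y +Q x)
  +Q-comm (a /p^ e) (b /p^ f) n = a≡b⇒k∣a-b (lemma (r a n) (r b n) (P e) (P f) (P-+ f e) (P-+ e f))
    where
    lemma : ∀ A B Pe Pf {Pfe Pef} → Pfe ≡ Pf * Pe → Pef ≡ Pe * Pf → (A * Pf + B * Pe) * Pfe ≡ (B * Pe + A * Pf) * Pef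
    lemma A B Pe Pf ≡.refl ≡.refl = solve (A ∷ B ∷ Pe ∷ Pf ∷ [])

  *Q-assoc : ∀ x y z → ((x *Q y) *Q z) ≈Q (x *Q (y *Q z))
  *Q-assoc (a /p^ e) (b /p^ f) (c /p^ g) n = a≡b⇒k∣a-b (lemma (r a n) (r b n) (r c n) (ℕ.+-assoc e f g))
    where
    lemma : ∀ A B C {u v} → u ≡ v → (A * B * C) * P v ≡ (A * (B * C)) * P u
    lemma A B C {u} ≡.refl = ≡.cong (_* P u) (ℤ.*-assoc A B C)

  *Q-identityˡ : ∀ x → (1Q *Q x) ≈Q x
  *Q-identityˡ (a /p^ e) n = a≡b⇒k∣a-b (≡.cong (_* P e) (ℤ.*-identityˡ (r a n)))

  *Q-identityʳ : ∀ x → (x *Q 1Q) ≈Q x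
  *Q-identityʳ (a /p^ e) n = a≡b⇒k∣a-b (≡.cong₂ _*_ (ℤ.*-identityʳ (r a n)) (≡.cong P (≡.sym (ℕ.+-identityʳ e))))

  *Q-distribˡ : ∀ x y z → (x *Q (y +Q z)) ≈Q ((x *Q y) +Q (x *Q z))
  *Q-distribˡ (a /p^ e) (b /p^ f) (c /p^ g) n =
    a≡b⇒k∣a-b (lemma (r a n) (r b n) (r c n) (P e) (P f) (P g) (P-+ e f) (P-+ e g) (P-+ (e ℕ.+ f) (e ℕ.+ g)) (P-+ f g) (P-+ e (f ℕ.+ g)))
    where
    lemma : ∀ A B C Pe Pf Pg {Pef Peg Pef+eg Pfg Pe+fg} → Pef ≡ Pe * Pf → Peg ≡ Pe * Pg →
            Pef+eg ≡ Pef * Peg → Pfg ≡ Pf * Pg → Pe+fg ≡ Pe * Pfg →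
            (A * (B * Pg + C * Pf)) * Pef+eg ≡ ((A * B) * Peg + (A * C) * Pef) * Pe+fg
    lemma A B C Pe Pf Pg ≡.refl ≡.refl ≡.refl ≡.refl ≡.refl = solve (A ∷ B ∷ C ∷ Pe ∷ Pf ∷ Pg ∷ [])

  *Q-comm : ∀ x y → (x *Q y) ≈Q (y *Q x)
  *Q-comm (a /p^ e) (b /p^ f) n = a≡b⇒k∣a-b (≡.cong₂ _*_ (ℤ.*-comm (r a n) (r b n)) (≡.cong P (ℕ.+-comm f e)))

  ≈Q-isEquivalence : IsEquivalence _≈Q_
  ≈Q-isEquivalence = record
    { refl = λ {x} → ≈Q-refl {x} ; sym = λ {x} {y} → ≈Q-sym {x} {y} ; trans = λ {x} {y} {z} → ≈Q-trans {x} {y} {z} }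

  ≈Q-setoid : Setoid 0ℓ 0ℓ
  ≈Q-setoid = record { isEquivalence = ≈Q-isEquivalence }

  ℚₚ : CommutativeRing 0ℓ 0ℓ
  ℚₚ = record
    { Carrier = Qp ; _≈_ = _≈Q_ ; _+_ = _+Q_ ; _*_ = _*Q_ ; -_ = -Q_ ; 0# = 0Q ; 1# = 1Q
    ; isCommutativeRing = record
      { isRing = record
        { +-isAbelianGroup = record
          { isGroup = record
            { isMonoid = record
              { isSemigroup = record
                { isMagma = record
                  { isEquivalence = ≈Q-isEquivalence
                  ; ∙-cong = λ {x} {x′} {y} {y′} → +Q-cong {x} {x′} {y} {y′} }
                ; assoc = +Q-assoc }
              ; identity = +Q-identityˡ , +Q-identityʳ }
            ; inverse = -Q-inverseˡ , -Q-inverseʳ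
            ; ⁻¹-cong = λ {x} {y} → -Q-cong {x} {y} }
          ; comm = +Q-comm }
        ; *-cong = λ {x} {x′} {y} {y′} → *Q-cong {x} {x′} {y} {y′}
        ; *-assoc = *Q-assoc
        ; *-identity = *Q-identityˡ , *Q-identityʳ
        ; distrib = *Q-distribˡ , comm∧distrˡ⇒distrʳ ≈Q-setoid {_*Q_} {_+Q_} (λ {x} {x′} {y} {y′} → +Q-cong {x} {x′} {y} {y′}) *Q-comm *Q-distribˡ }
      ; *-comm = *Q-comm } }

  ι-isRingMonomorphism : IsRingMonomorphism (CommutativeRing.rawRing ℤₚ) (CommutativeRing.rawRing ℚₚ) ι
  ι-isRingMonomorphism = record
    { isRingHomomorphism = record
      { isSemiringHomomorphism = record
        { isNearSemiringHomomorphism = record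
          { +-isMonoidHomomorphism = record
            { isMagmaHomomorphism = record
              { isRelHomomorphism = record { cong = λ {x} {y} → ι-cong {x} {y} }
              ; homo = λ x y n → a≡b⇒k∣a-b (lemma (r x n) (r y n)) }
            ; ε-homo = ≈Q-refl {0Q} }
          ; *-homo = λ x y → ≈Q-refl {ι (x *ᶻ y)} }
        ; 1#-homo = ≈Q-refl {1Q} }
      ; -‿homo = λ x → ≈Q-refl {ι (-ᶻ x)} }
    ; injective = λ {x} {y} → ι-injective {x} {y} }
    where
    lemma : ∀ X Y → (X + Y) * + 1 ≡ (X * + 1 + Y * + 1) * + 1
    lemma = solve-∀
    ι-cong : ∀ {x y} → x ≈ y → ι x ≈Q ι y
    ι-cong {x} {y} x≈y n = ∣-resp-≡ (one (r x n) (r y n)) (x≈y n)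
      where one : ∀ X Y → X - Y ≡ X * + 1 - Y * + 1
            one = solve-∀
    ι-injective : ∀ {x y} → ι x ≈Q ι y → x ≈ y
    ι-injective {x} {y} ιx≈ιy n = ∣-resp-≡ (one (r x n) (r y n)) (ιx≈ιy n)
      where one : ∀ X Y → X * + 1 - Y * + 1 ≡ X - Y
            one = solve-∀

module MatrixOps {c ℓ} (R : RawRing c ℓ) where
  open RawRing R

  Matrix : Set c
  Matrix = Fin 4 → Fin 4 → Carrier

  Matrix₂ : Set c
  Matrix₂ = Fin 2 → Fin 2 → Carrier

  ∑₄ : (Fin 4 → Carrier) → Carrier
  ∑₄ f = f 0F + f 1F + f 2F + f 3F

  infixl 7 _·_
  _·_ : Matrix → Matrix → Matrix
  (g · h) i j = ∑₄ λ a → g i a * h a j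

  ᵀ : Matrix → Matrix
  ᵀ g i j = g j i

  scale : Carrier → Matrix → Matrix
  scale c g i j = c * g i j

  δ : ∀ {n} → Fin n → Fin n → Carrier
  δ zero    zero    = 1#
  δ zero    (suc _) = 0#
  δ (suc _) zero    = 0#
  δ (suc i) (suc j) = δ i j

  1ᴹ : Matrix
  1ᴹ = δ

  gram : Matrix → Matrix → Matrix
  gram S g = ᵀ g · S · g

  J : Matrix
  J 0F 3F = 1#
  J 1F 2F = 1#
  J 2F 1F = - 1#
  J 3F 0F = - 1#
  J _  _  = 0#

  det₂ : Matrix₂ → Carrier
  det₂ B = B 0F 0F * B 1F 1F + - (B 0F 1F * B 1F 0F)

  det₃ : (Fin 3 → Fin 3 → Carrier) → Carrier
  det₃ M = M 0F 0F * det₂ (minor 0F 0F) + - (M 0F 1F * det₂ (minor 0F 1F)) + M 0F 2F * det₂ (minor 0F 2F)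
    where
    minor : Fin 3 → Fin 3 → Matrix₂
    minor i j a b = M (punchIn i a) (punchIn j b)

  alternate : ℕ → Carrier → Carrier
  alternate zero    x = x
  alternate (suc k) x = - alternate k x

  adj : Matrix → Matrix
  adj g i j = alternate (toℕ i ℕ.+ toℕ j) (det₃ λ a b → g (punchIn j a) (punchIn i b))

  det : Matrix → Carrier
  det g = ∑₄ λ j → g 0F j * adj g j 0F

  Pf : Matrix → Carrier
  Pf S = S 0F 1F * S 2F 3F + - (S 0F 2F * S 1F 3F) + S 0F 3F * S 1F 2F

  embed : Matrix₂ → Matrix₂ → Matrix
  embed A A′ 0F 0F = A 0F 0F
  embed A A′ 0F 3F = A 0F 1F
  embed A A′ 3F 0F = A 1F 0F
  embed A A′ 3F 3F = A 1F 1F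
  embed A A′ 1F 1F = A′ 0F 0F
  embed A A′ 1F 2F = A′ 0F 1F
  embed A A′ 2F 1F = A′ 1F 0F
  embed A A′ 2F 2F = A′ 1F 1F
  embed A A′ _  _  = 0#

module Matrices {c ℓ} (R : CommutativeRing c ℓ) where
  open CommutativeRing R public hiding (zero)
  open MatrixOps rawRing public
  open import Algebra.Properties.Semiring.Sum semiring using (sum; sum-cong-≋; ∑-comm; *-distribˡ-sum; *-distribʳ-sum)
  open import Algebra.Properties.CommutativeSemigroup *-commutativeSemigroup using (interchange)
  module ≈-Reasoning = Relation.Binary.Reasoning.Setoid setoid

  *-zeroʳ-≈ : ∀ x {y} → y ≈ 0# → x * y ≈ 0#
  *-zeroʳ-≈ x y≈0 = trans (*-congˡ y≈0) (zeroʳ x)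

  *-zeroˡ-≈ : ∀ y {x} → x ≈ 0# → x * y ≈ 0#
  *-zeroˡ-≈ y x≈0 = trans (*-congʳ x≈0) (zeroˡ y)

  x[cy]≈c[xy] : ∀ x c y → x * (c * y) ≈ c * (x * y)
  x[cy]≈c[xy] x c y = trans (sym (*-assoc x c y)) (trans (*-congʳ (*-comm x c)) (*-assoc c x y))

  drop-zeroʳ : ∀ {a b c} → b ≈ 0# → a + b ≈ c → a ≈ c
  drop-zeroʳ {a} b≈0 a+b≈c = trans (trans (sym (+-identityʳ a)) (+-congˡ (sym b≈0))) a+b≈c

  drop-zeroˡ : ∀ {a b c} → a ≈ 0# → a + b ≈ c → b ≈ c
  drop-zeroˡ {a} {b} a≈0 a+b≈c = trans (trans (sym (+-identityˡ b)) (+-congʳ (sym a≈0))) a+b≈c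

  annihilated-by-unit : ∀ {x y u} → x * u ≈ 1# → x * y ≈ 0# → y ≈ 0#
  annihilated-by-unit {x} {y} {u} xu≈1 xy≈0 = begin
    y              ≈⟨ *-identityˡ y ⟨
    1# * y         ≈⟨ *-congʳ (trans (*-comm u x) xu≈1) ⟨
    (u * x) * y    ≈⟨ *-assoc u x y ⟩
    u * (x * y)    ≈⟨ *-zeroʳ-≈ u xy≈0 ⟩
    0#             ∎
    where open ≈-Reasoning

  ∑₄-cong : ∀ {f f′} → (∀ a → f a ≈ f′ a) → ∑₄ f ≈ ∑₄ f′
  ∑₄-cong f≈f′ = +-cong (+-cong (+-cong (f≈f′ 0F) (f≈f′ 1F)) (f≈f′ 2F)) (f≈f′ 3F)

  ∑₄≈sum : ∀ f → ∑₄ f ≈ sum f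
  ∑₄≈sum f = begin
    f 0F + f 1F + f 2F + f 3F             ≈⟨ +-assoc (f 0F + f 1F) (f 2F) (f 3F) ⟩
    f 0F + f 1F + (f 2F + f 3F)           ≈⟨ +-assoc (f 0F) (f 1F) (f 2F + f 3F) ⟩
    f 0F + (f 1F + (f 2F + f 3F))         ≈⟨ +-congˡ (+-congˡ (+-congˡ (+-identityʳ (f 3F)))) ⟨
    f 0F + (f 1F + (f 2F + (f 3F + 0#)))  ∎
    where open ≈-Reasoning

  *-∑₄ : ∀ c f → c * ∑₄ f ≈ ∑₄ (λ a → c * f a)
  *-∑₄ c f = begin
    c * ∑₄ f              ≈⟨ *-congˡ (∑₄≈sum f) ⟩
    c * sum f             ≈⟨ *-distribˡ-sum c f ⟩
    sum (λ a → c * f a)   ≈⟨ ∑₄≈sum (λ a → c * f a) ⟨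
    ∑₄ (λ a → c * f a)    ∎
    where open ≈-Reasoning

  ∑₄-supported₀ : ∀ f → f 1F ≈ 0# → f 2F ≈ 0# → f 3F ≈ 0# → ∑₄ f ≈ f 0F
  ∑₄-supported₀ f f₁≈0 f₂≈0 f₃≈0 = begin
    f 0F + f 1F + f 2F + f 3F   ≈⟨ +-cong (+-cong (+-congˡ f₁≈0) f₂≈0) f₃≈0 ⟩
    f 0F + 0# + 0# + 0#         ≈⟨ +-identityʳ _ ⟩
    f 0F + 0# + 0#              ≈⟨ +-identityʳ _ ⟩
    f 0F + 0#                   ≈⟨ +-identityʳ _ ⟩
    f 0F                        ∎
    where open ≈-Reasoning

  ∑₄-supported₀₁ : ∀ f → f 2F ≈ 0# → f 3F ≈ 0# → ∑₄ f ≈ f 0F + f 1F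
  ∑₄-supported₀₁ f f₂≈0 f₃≈0 = begin
    f 0F + f 1F + f 2F + f 3F   ≈⟨ +-cong (+-congˡ f₂≈0) f₃≈0 ⟩
    f 0F + f 1F + 0# + 0#       ≈⟨ +-identityʳ _ ⟩
    f 0F + f 1F + 0#            ≈⟨ +-identityʳ _ ⟩
    f 0F + f 1F                 ∎
    where open ≈-Reasoning

  ∑₄-supported₃ : ∀ f → f 0F ≈ 0# → f 1F ≈ 0# → f 2F ≈ 0# → ∑₄ f ≈ f 3F
  ∑₄-supported₃ f f₀≈0 f₁≈0 f₂≈0 = begin
    f 0F + f 1F + f 2F + f 3F   ≈⟨ +-congʳ (+-cong (+-cong f₀≈0 f₁≈0) f₂≈0) ⟩
    0# + 0# + 0# + f 3F         ≈⟨ +-congʳ (trans (+-identityʳ _) (+-identityʳ _)) ⟩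
    0# + f 3F                   ≈⟨ +-identityˡ _ ⟩
    f 3F                        ∎
    where open ≈-Reasoning

  infix 4 _≈ᴹ_
  _≈ᴹ_ : Matrix → Matrix → Set ℓ
  g ≈ᴹ h = ∀ i j → g i j ≈ h i j

  ≈ᴹ-sym : ∀ {g h} → g ≈ᴹ h → h ≈ᴹ g
  ≈ᴹ-sym g≈h i j = sym (g≈h i j)

  ≈ᴹ-trans : ∀ {g h k} → g ≈ᴹ h → h ≈ᴹ k → g ≈ᴹ k
  ≈ᴹ-trans g≈h h≈k i j = trans (g≈h i j) (h≈k i j)

  ≈ᴹ-setoid : Setoid c ℓ
  ≈ᴹ-setoid = record
    { Carrier = Matrix
    ; _≈_ = _≈ᴹ_
    ; isEquivalence = record { refl = λ _ _ → refl ; sym = ≈ᴹ-sym ; trans = ≈ᴹ-trans } }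

  module ≈ᴹ-Reasoning = Relation.Binary.Reasoning.Setoid ≈ᴹ-setoid

  ·-congˡ : ∀ g {h h′} → h ≈ᴹ h′ → g · h ≈ᴹ g · h′
  ·-congˡ g h≈h′ i j = ∑₄-cong λ a → *-congˡ {g i a} (h≈h′ a j)

  ·-congʳ : ∀ h {g g′} → g ≈ᴹ g′ → g · h ≈ᴹ g′ · h
  ·-congʳ h g≈g′ i j = ∑₄-cong λ a → *-congʳ {h a j} (g≈g′ i a)

  ·-assoc : ∀ g h k → (g · h) · k ≈ᴹ g · (h · k)
  ·-assoc g h k i j = begin
    ∑₄ (λ b → (g · h) i b * k b j)             ≈⟨ ∑₄≈sum (λ b → (g · h) i b * k b j) ⟩
    ∑ (λ b → (g · h) i b * k b j)              ≈⟨ ∑-cong (λ b → *-congʳ {k b j} (∑₄≈sum (λ a → g i a * h a b))) ⟩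
    ∑ (λ b → ∑ (λ a → g i a * h a b) * k b j)  ≈⟨ ∑-cong (λ b → *-distribʳ-sum (k b j) (λ a → g i a * h a b)) ⟩
    ∑ (λ b → ∑ (λ a → g i a * h a b * k b j))  ≈⟨ ∑-comm (λ b a → g i a * h a b * k b j) ⟩
    ∑ (λ a → ∑ (λ b → g i a * h a b * k b j))  ≈⟨ ∑-cong (λ a → ∑-cong (λ b → *-assoc (g i a) (h a b) (k b j))) ⟩
    ∑ (λ a → ∑ (λ b → g i a * (h a b * k b j))) ≈⟨ ∑-cong (λ a → *-distribˡ-sum (g i a) (λ b → h a b * k b j)) ⟨
    ∑ (λ a → g i a * ∑ (λ b → h a b * k b j))  ≈⟨ ∑-cong (λ a → *-congˡ {g i a} (∑₄≈sum (λ b → h a b * k b j))) ⟨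
    ∑ (λ a → g i a * (h · k) a j)              ≈⟨ ∑₄≈sum (λ a → g i a * (h · k) a j) ⟨
    ∑₄ (λ a → g i a * (h · k) a j)             ∎
    where
    ∑ : (Fin 4 → Carrier) → Carrier
    ∑ = sum
    ∑-cong : ∀ {f f′ : Fin 4 → Carrier} → (∀ a → f a ≈ f′ a) → ∑ f ≈ ∑ f′
    ∑-cong = sum-cong-≋
    open ≈-Reasoning

  ∑-*δ : ∀ {n} (f : Fin n → Carrier) j → sum (λ a → f a * δ a j) ≈ f j
  ∑-*δ {suc n} f zero = begin
    f zero * 1# + sum (λ a → f (suc a) * 0#)   ≈⟨ +-cong (*-identityʳ (f zero)) (sym (*-distribʳ-sum 0# (λ a → f (suc a)))) ⟩
    f zero + sum (λ a → f (suc a)) * 0#        ≈⟨ +-congˡ (zeroʳ _) ⟩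
    f zero + 0#                                ≈⟨ +-identityʳ (f zero) ⟩
    f zero                                     ∎
    where open ≈-Reasoning
  ∑-*δ {suc n} f (suc j) = begin
    f zero * 0# + sum (λ a → f (suc a) * δ a j) ≈⟨ +-cong (zeroʳ (f zero)) (∑-*δ (λ a → f (suc a)) j) ⟩
    0# + f (suc j)                              ≈⟨ +-identityˡ (f (suc j)) ⟩
    f (suc j)                                   ∎
    where open ≈-Reasoning

  δ-sym : ∀ {n} (i j : Fin n) → δ i j ≡ δ j i
  δ-sym zero    zero    = ≡.refl
  δ-sym zero    (suc _) = ≡.refl
  δ-sym (suc _) zero    = ≡.refl
  δ-sym (suc i) (suc j) = δ-sym i j

  ·-identityʳ : ∀ g → g · 1ᴹ ≈ᴹ g
  ·-identityʳ g i j = trans (∑₄≈sum (λ a → g i a * δ a j)) (∑-*δ (g i) j)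

  ·-identityˡ : ∀ g → 1ᴹ · g ≈ᴹ g
  ·-identityˡ g i j = begin
    ∑₄ (λ a → δ i a * g a j)  ≈⟨ ∑₄-cong (λ a → trans (*-comm (δ i a) (g a j)) (*-congˡ (reflexive (δ-sym i a)))) ⟩
    ∑₄ (λ a → g a j * δ a i)  ≈⟨ ·-identityʳ (ᵀ g) j i ⟩
    g i j                     ∎
    where open ≈-Reasoning

  ·-cancelˡ : ∀ g g′ x → g · g′ ≈ᴹ 1ᴹ → g · (g′ · x) ≈ᴹ x
  ·-cancelˡ g g′ x gg′≈1 = ≈ᴹ-trans (≈ᴹ-sym (·-assoc g g′ x)) (≈ᴹ-trans (·-congʳ x gg′≈1) (·-identityˡ x))

  ·-cancelʳ : ∀ g′ g x → g′ · g ≈ᴹ 1ᴹ → (x · g′) · g ≈ᴹ x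
  ·-cancelʳ g′ g x g′g≈1 = ≈ᴹ-trans (·-assoc x g′ g) (≈ᴹ-trans (·-congˡ x g′g≈1) (·-identityʳ x))

  ·-solveʳ : ∀ h g g′ x → h · g ≈ᴹ x → g · g′ ≈ᴹ 1ᴹ → h ≈ᴹ x · g′
  ·-solveʳ h g g′ x hg≈x gg′≈1 = ≈ᴹ-trans (≈ᴹ-sym (·-cancelʳ g g′ h gg′≈1)) (·-congʳ g′ hg≈x)

  ·-inverseˡ : ∀ g h h′ → g · h ≈ᴹ 1ᴹ → h · h′ ≈ᴹ 1ᴹ → h · g ≈ᴹ 1ᴹ
  ·-inverseˡ g h h′ gh≈1 hh′≈1 = ≈ᴹ-trans (·-congˡ h g≈h′) hh′≈1
    where
    g≈h′ : g ≈ᴹ h′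
    g≈h′ = ≈ᴹ-trans (≈ᴹ-sym (·-cancelʳ h h′ g hh′≈1)) (≈ᴹ-trans (·-congʳ h′ gh≈1) (·-identityˡ h′))

  ᵀ-· : ∀ g h → ᵀ (g · h) ≈ᴹ ᵀ h · ᵀ g
  ᵀ-· g h i j = ∑₄-cong λ a → *-comm (g j a) (h a i)

  ᵀ-1ᴹ : ᵀ 1ᴹ ≈ᴹ 1ᴹ
  ᵀ-1ᴹ i j = reflexive (δ-sym j i)

  ·-column-e₀ : ∀ g h j → h 1F j ≈ 0# → h 2F j ≈ 0# → h 3F j ≈ 0# → ∀ i → (g · h) i j ≈ g i 0F * h 0F j
  ·-column-e₀ g h j h₁≈0 h₂≈0 h₃≈0 i =
    ∑₄-supported₀ (λ a → g i a * h a j) (*-zeroʳ-≈ _ h₁≈0) (*-zeroʳ-≈ _ h₂≈0) (*-zeroʳ-≈ _ h₃≈0)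

  ·-row-e₀ : ∀ g h i → g i 1F ≈ 0# → g i 2F ≈ 0# → g i 3F ≈ 0# → ∀ j → (g · h) i j ≈ g i 0F * h 0F j
  ·-row-e₀ g h i g₁≈0 g₂≈0 g₃≈0 j =
    ∑₄-supported₀ (λ a → g i a * h a j) (*-zeroˡ-≈ _ g₁≈0) (*-zeroˡ-≈ _ g₂≈0) (*-zeroˡ-≈ _ g₃≈0)

  ·-column-e₀+e₁ : ∀ g h j → h 0F j ≈ 1# → h 1F j ≈ 1# → h 2F j ≈ 0# → h 3F j ≈ 0# →
                   ∀ i → (g · h) i j ≈ g i 0F + g i 1F
  ·-column-e₀+e₁ g h j h₀≈1 h₁≈1 h₂≈0 h₃≈0 i =
    trans (∑₄-supported₀₁ (λ a → g i a * h a j) (*-zeroʳ-≈ _ h₂≈0) (*-zeroʳ-≈ _ h₃≈0))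
          (+-cong (trans (*-congˡ h₀≈1) (*-identityʳ _)) (trans (*-congˡ h₁≈1) (*-identityʳ _)))

  ·-column-scaled : ∀ g h h′ c j → (∀ a → h a j ≈ c * h′ a j) → ∀ i → (g · h) i j ≈ c * (g · h′) i j
  ·-column-scaled g h h′ c j h≈ch′ i =
    trans (∑₄-cong λ a → trans (*-congˡ (h≈ch′ a)) (x[cy]≈c[xy] (g i a) c (h′ a j))) (sym (*-∑₄ c λ a → g i a * h′ a j))

  scale-congˡ : ∀ g {c c′} → c ≈ c′ → scale c g ≈ᴹ scale c′ g
  scale-congˡ g c≈c′ i j = *-congʳ c≈c′

  scale-congʳ : ∀ c {g g′} → g ≈ᴹ g′ → scale c g ≈ᴹ scale c g′
  scale-congʳ c g≈g′ i j = *-congˡ (g≈g′ i j)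

  scale-scale : ∀ a b g → scale a (scale b g) ≈ᴹ scale (a * b) g
  scale-scale a b g i j = sym (*-assoc a b (g i j))

  scale-one : ∀ {c} g → c ≈ 1# → scale c g ≈ᴹ g
  scale-one g c≈1 i j = trans (*-congʳ c≈1) (*-identityˡ (g i j))

  ·-scaleˡ : ∀ c g h → scale c g · h ≈ᴹ scale c (g · h)
  ·-scaleˡ c g h i j = trans (∑₄-cong λ a → *-assoc c (g i a) (h a j)) (sym (*-∑₄ c λ a → g i a * h a j))

  ·-scaleʳ : ∀ c g h → g · scale c h ≈ᴹ scale c (g · h)
  ·-scaleʳ c g h i j = ·-column-scaled g (scale c h) h c j (λ _ → refl) i

  gram-congˡ : ∀ g {S S′} → S ≈ᴹ S′ → gram S g ≈ᴹ gram S′ g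
  gram-congˡ g S≈S′ = ·-congʳ g (·-congˡ (ᵀ g) S≈S′)

  gram-congʳ : ∀ S {g g′} → g ≈ᴹ g′ → gram S g ≈ᴹ gram S g′
  gram-congʳ S {g} {g′} g≈g′ = ≈ᴹ-trans (·-congʳ g (·-congʳ S λ i j → g≈g′ j i)) (·-congˡ (ᵀ g′ · S) g≈g′)

  gram-· : ∀ S g h → gram S (g · h) ≈ᴹ gram (gram S g) h
  gram-· S g h = begin
    ᵀ (g · h) · S · (g · h)     ≈⟨ ·-congʳ (g · h) (·-congʳ S (ᵀ-· g h)) ⟩
    ᵀ h · ᵀ g · S · (g · h)     ≈⟨ ·-assoc (ᵀ h · ᵀ g · S) g h ⟨
    ᵀ h · ᵀ g · S · g · h       ≈⟨ ·-congʳ h (·-congʳ g (·-assoc (ᵀ h) (ᵀ g) S)) ⟩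
    ᵀ h · (ᵀ g · S) · g · h     ≈⟨ ·-congʳ h (·-assoc (ᵀ h) (ᵀ g · S) g) ⟩
    ᵀ h · gram S g · h          ∎
    where open ≈ᴹ-Reasoning

  gram-scale : ∀ c S g → gram (scale c S) g ≈ᴹ scale c (gram S g)
  gram-scale c S g = ≈ᴹ-trans (·-congʳ g (·-scaleʳ c (ᵀ g) S)) (·-scaleˡ c (ᵀ g · S) g)

  gram-1ᴹ : ∀ S → gram S 1ᴹ ≈ᴹ S
  gram-1ᴹ S = ≈ᴹ-trans (·-identityʳ (ᵀ 1ᴹ · S)) (≈ᴹ-trans (·-congʳ S ᵀ-1ᴹ) (·-identityˡ S))

  gram-row₀ : ∀ S g → (∀ b → S 0F b ≈ δ 3F b) → g 1F 0F ≈ 0# → g 2F 0F ≈ 0# → g 3F 0F ≈ 0# →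
              ∀ j → gram S g 0F j ≈ g 0F 0F * g 3F j
  gram-row₀ S g S₀≈e₃ g₁≈0 g₂≈0 g₃≈0 j = begin
    ∑₄ (λ b → (ᵀ g · S) 0F b * g b j)        ≈⟨ ∑₄-cong (λ b → *-congʳ {g b j} (row b)) ⟩
    ∑₄ (λ b → g 0F 0F * δ 3F b * g b j)      ≈⟨ ∑₄-supported₃ (λ b → g 0F 0F * δ 3F b * g b j) (vanishes _) (vanishes _) (vanishes _) ⟩
    g 0F 0F * 1# * g 3F j                    ≈⟨ *-congʳ (*-identityʳ _) ⟩
    g 0F 0F * g 3F j                         ∎
    where
    open ≈-Reasoning
    row : ∀ b → (ᵀ g · S) 0F b ≈ g 0F 0F * δ 3F b
    row b = trans (·-row-e₀ (ᵀ g) S 0F g₁≈0 g₂≈0 g₃≈0 b) (*-congˡ (S₀≈e₃ b))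
    vanishes : ∀ x → g 0F 0F * 0# * x ≈ 0#
    vanishes x = trans (*-congʳ (zeroʳ _)) (zeroˡ x)

  IsSimilitude : Matrix → Carrier → Matrix → Set ℓ
  IsSimilitude S ν g = gram S g ≈ᴹ scale ν S

  similitude-cong : ∀ S g {ν ν′} → ν ≈ ν′ → IsSimilitude S ν g → IsSimilitude S ν′ g
  similitude-cong S g ν≈ν′ sim = ≈ᴹ-trans sim (scale-congˡ S ν≈ν′)

  similitude-· : ∀ S {ν μ} g h → IsSimilitude S ν g → IsSimilitude S μ h → IsSimilitude S (ν * μ) (g · h)
  similitude-· S {ν} {μ} g h sim-g sim-h = begin
    gram S (g · h)          ≈⟨ gram-· S g h ⟩
    gram (gram S g) h       ≈⟨ gram-congˡ h sim-g ⟩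
    gram (scale ν S) h      ≈⟨ gram-scale ν S h ⟩
    scale ν (gram S h)      ≈⟨ scale-congʳ ν sim-h ⟩
    scale ν (scale μ S)     ≈⟨ scale-scale ν μ S ⟩
    scale (ν * μ) S         ∎
    where open ≈ᴹ-Reasoning

  similitude-inverse : ∀ S {ν μ} g h → IsSimilitude S ν g → ν * μ ≈ 1# → g · h ≈ᴹ 1ᴹ → IsSimilitude S μ h
  similitude-inverse S {ν} {μ} g h sim-g νμ≈1 gh≈1 = begin
    gram S h                      ≈⟨ scale-one (gram S h) (trans (*-comm μ ν) νμ≈1) ⟨
    scale (μ * ν) (gram S h)      ≈⟨ scale-scale μ ν (gram S h) ⟨
    scale μ (scale ν (gram S h))  ≈⟨ scale-congʳ μ (gram-scale ν S h) ⟨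
    scale μ (gram (scale ν S) h)  ≈⟨ scale-congʳ μ (gram-congˡ h sim-g) ⟨
    scale μ (gram (gram S g) h)   ≈⟨ scale-congʳ μ (gram-· S g h) ⟨
    scale μ (gram S (g · h))      ≈⟨ scale-congʳ μ (gram-congʳ S gh≈1) ⟩
    scale μ (gram S 1ᴹ)           ≈⟨ scale-congʳ μ (gram-1ᴹ S) ⟩
    scale μ S                     ∎
    where open ≈ᴹ-Reasoning

  open FromInteger R using (homomorphism; coefficient≟)
  open import Algebra.Solver.Ring ℤ.+-*-rawRing (fromCommutativeRing R) homomorphism coefficient≟
    using (Polynomial; var; con; _:+_; _:*_; :-_; prove)

  polynomials : ℕ → RawRing 0ℓ 0ℓ
  polynomials n = record
    { Carrier = Polynomial n ; _≈_ = _≡_ ; _+_ = _:+_ ; _*_ = _:*_ ; -_ = :-_ ; 0# = con (+ 0) ; 1# = con (+ 1) }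

  -- Polynomial identities are checked entry by entry by the ring solver, on formal matrices whose
  -- (a , b) entry is the variable combine a b; entries and entries₂ are the matching environments.
  module F₁₆ = MatrixOps (polynomials 16)
  module F₈ = MatrixOps (polynomials 8)

  generic : F₁₆.Matrix
  generic a b = var (Fin.combine a b)

  entries : Matrix → Vec Carrier 16
  entries g = tabulate λ k → uncurry g (Fin.remQuot {4} 4 k)

  genericˡ genericʳ : F₈.Matrix₂
  genericˡ a b = var (Fin.combine a b Fin.↑ˡ 4)
  genericʳ a b = var (4 Fin.↑ʳ Fin.combine a b)

  entries₂ : Matrix₂ → Matrix₂ → Vec Carrier 8
  entries₂ B B′ = tabulate (λ k → uncurry B (Fin.remQuot {2} 2 k)) ++ tabulate (λ k → uncurry B′ (Fin.remQuot {2} 2 k))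

  private
    g·adj[g] det[g]·1 : Fin 4 → Fin 4 → Polynomial 16
    g·adj[g] i j = (generic F₁₆.· F₁₆.adj generic) i j
    det[g]·1 i j = F₁₆.scale (F₁₆.det generic) F₁₆.1ᴹ i j

    gram[embed] : Fin 4 → Fin 4 → Polynomial 8
    gram[embed] i j = F₈.gram F₈.J (F₈.embed genericˡ genericʳ) i j

    _·J : Polynomial 8 → Fin 4 → Fin 4 → Polynomial 8
    (d ·J) i j = F₈.scale d F₈.J i j

  adj-right : ∀ g → g · adj g ≈ᴹ scale (det g) 1ᴹ
  adj-right g 0F 0F = prove (entries g) (g·adj[g] 0F 0F) (det[g]·1 0F 0F) refl
  adj-right g 0F 1F = prove (entries g) (g·adj[g] 0F 1F) (det[g]·1 0F 1F) refl
  adj-right g 0F 2F = prove (entries g) (g·adj[g] 0F 2F) (det[g]·1 0F 2F) refl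
  adj-right g 0F 3F = prove (entries g) (g·adj[g] 0F 3F) (det[g]·1 0F 3F) refl
  adj-right g 1F 0F = prove (entries g) (g·adj[g] 1F 0F) (det[g]·1 1F 0F) refl
  adj-right g 1F 1F = prove (entries g) (g·adj[g] 1F 1F) (det[g]·1 1F 1F) refl
  adj-right g 1F 2F = prove (entries g) (g·adj[g] 1F 2F) (det[g]·1 1F 2F) refl
  adj-right g 1F 3F = prove (entries g) (g·adj[g] 1F 3F) (det[g]·1 1F 3F) refl
  adj-right g 2F 0F = prove (entries g) (g·adj[g] 2F 0F) (det[g]·1 2F 0F) refl
  adj-right g 2F 1F = prove (entries g) (g·adj[g] 2F 1F) (det[g]·1 2F 1F) refl
  adj-right g 2F 2F = prove (entries g) (g·adj[g] 2F 2F) (det[g]·1 2F 2F) refl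
  adj-right g 2F 3F = prove (entries g) (g·adj[g] 2F 3F) (det[g]·1 2F 3F) refl
  adj-right g 3F 0F = prove (entries g) (g·adj[g] 3F 0F) (det[g]·1 3F 0F) refl
  adj-right g 3F 1F = prove (entries g) (g·adj[g] 3F 1F) (det[g]·1 3F 1F) refl
  adj-right g 3F 2F = prove (entries g) (g·adj[g] 3F 2F) (det[g]·1 3F 2F) refl
  adj-right g 3F 3F = prove (entries g) (g·adj[g] 3F 3F) (det[g]·1 3F 3F) refl

  det≈Pf-gram : ∀ g → det g ≈ Pf (gram J g)
  det≈Pf-gram g = prove (entries g) (F₁₆.det generic) (F₁₆.Pf (F₁₆.gram F₁₆.J generic)) refl

  Pf-cong : ∀ {S S′} → S ≈ᴹ S′ → Pf S ≈ Pf S′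
  Pf-cong S≈S′ = +-cong (+-cong (*-cong (S≈S′ _ _) (S≈S′ _ _)) (-‿cong (*-cong (S≈S′ _ _) (S≈S′ _ _)))) (*-cong (S≈S′ _ _) (S≈S′ _ _))

  Pf-scale-J : ∀ c → Pf (scale c J) ≈ c * c
  Pf-scale-J c = prove [ c ] (F₁.Pf (F₁.scale x F₁.J)) (x :* x) refl
    where
    module F₁ = MatrixOps (polynomials 1)
    x = var 0F

  gram-embed₀₃ : ∀ B B′ → gram J (embed B B′) 0F 3F ≈ det₂ B
  gram-embed₀₃ B B′ = prove (entries₂ B B′) (gram[embed] 0F 3F) (F₈.det₂ genericˡ) refl

  gram-embed₁₂ : ∀ B B′ → gram J (embed B B′) 1F 2F ≈ det₂ B′
  gram-embed₁₂ B B′ = prove (entries₂ B B′) (gram[embed] 1F 2F) (F₈.det₂ genericʳ) refl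

  embed-similitude : ∀ B B′ → det₂ B ≈ det₂ B′ → IsSimilitude J (det₂ B) (embed B B′)
  embed-similitude B B′ _    0F 0F = prove (entries₂ B B′) (gram[embed] 0F 0F) ((F₈.det₂ genericˡ ·J) 0F 0F) refl
  embed-similitude B B′ _    0F 1F = prove (entries₂ B B′) (gram[embed] 0F 1F) ((F₈.det₂ genericˡ ·J) 0F 1F) refl
  embed-similitude B B′ _    0F 2F = prove (entries₂ B B′) (gram[embed] 0F 2F) ((F₈.det₂ genericˡ ·J) 0F 2F) refl
  embed-similitude B B′ _    0F 3F = trans (gram-embed₀₃ B B′) (sym (*-identityʳ (det₂ B)))
  embed-similitude B B′ _    1F 0F = prove (entries₂ B B′) (gram[embed] 1F 0F) ((F₈.det₂ genericˡ ·J) 1F 0F) refl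
  embed-similitude B B′ _    1F 1F = prove (entries₂ B B′) (gram[embed] 1F 1F) ((F₈.det₂ genericˡ ·J) 1F 1F) refl
  embed-similitude B B′ d≈d′ 1F 2F = trans (gram-embed₁₂ B B′) (trans (sym d≈d′) (sym (*-identityʳ (det₂ B))))
  embed-similitude B B′ _    1F 3F = prove (entries₂ B B′) (gram[embed] 1F 3F) ((F₈.det₂ genericˡ ·J) 1F 3F) refl
  embed-similitude B B′ _    2F 0F = prove (entries₂ B B′) (gram[embed] 2F 0F) ((F₈.det₂ genericˡ ·J) 2F 0F) refl
  embed-similitude B B′ d≈d′ 2F 1F = trans (prove (entries₂ B B′) (gram[embed] 2F 1F) ((F₈.det₂ genericʳ ·J) 2F 1F) refl) (*-congʳ (sym d≈d′))
  embed-similitude B B′ _    2F 2F = prove (entries₂ B B′) (gram[embed] 2F 2F) ((F₈.det₂ genericˡ ·J) 2F 2F) refl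
  embed-similitude B B′ _    2F 3F = prove (entries₂ B B′) (gram[embed] 2F 3F) ((F₈.det₂ genericˡ ·J) 2F 3F) refl
  embed-similitude B B′ _    3F 0F = prove (entries₂ B B′) (gram[embed] 3F 0F) ((F₈.det₂ genericˡ ·J) 3F 0F) refl
  embed-similitude B B′ _    3F 1F = prove (entries₂ B B′) (gram[embed] 3F 1F) ((F₈.det₂ genericˡ ·J) 3F 1F) refl
  embed-similitude B B′ _    3F 2F = prove (entries₂ B B′) (gram[embed] 3F 2F) ((F₈.det₂ genericˡ ·J) 3F 2F) refl
  embed-similitude B B′ _    3F 3F = prove (entries₂ B B′) (gram[embed] 3F 3F) ((F₈.det₂ genericˡ ·J) 3F 3F) refl

  right-inverse : ∀ g u → det g * u ≈ 1# → g · scale u (adj g) ≈ᴹ 1ᴹ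
  right-inverse g u det·u≈1 = begin
    g · scale u (adj g)         ≈⟨ ·-scaleʳ u g (adj g) ⟩
    scale u (g · adj g)         ≈⟨ scale-congʳ u (adj-right g) ⟩
    scale u (scale (det g) 1ᴹ)  ≈⟨ scale-scale u (det g) 1ᴹ ⟩
    scale (u * det g) 1ᴹ        ≈⟨ scale-one 1ᴹ (trans (*-comm u (det g)) det·u≈1) ⟩
    1ᴹ                          ∎
    where open ≈ᴹ-Reasoning

  det-similitude : ∀ ν g → IsSimilitude J ν g → det g ≈ ν * ν
  det-similitude ν g sim = trans (det≈Pf-gram g) (trans (Pf-cong sim) (Pf-scale-J ν))

  record Inverse (g : Matrix) : Set (c ⊔ ℓ) where
    field
      g⁻¹      : Matrix
      inverseʳ : g · g⁻¹ ≈ᴹ 1ᴹ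
      inverseˡ : g⁻¹ · g ≈ᴹ 1ᴹ

  -- The multiplier forces det g = ν², a unit, so the adjugate gives a right inverse h; h is again a
  -- similitude, hence has a right inverse itself, which makes h a left inverse of g as well.
  similitude-invertible : ∀ g {ν μ} → IsSimilitude J ν g → ν * μ ≈ 1# → Inverse g
  similitude-invertible g {ν} {μ} sim νμ≈1 = record
    { g⁻¹ = h ; inverseʳ = gh≈1 ; inverseˡ = ·-inverseˡ g h (scale (ν * ν) (adj h)) gh≈1 hh′≈1 }
    where
    squares : ∀ {a b} → a * b ≈ 1# → (a * a) * (b * b) ≈ 1#
    squares {a} {b} ab≈1 = trans (interchange a a b b) (trans (*-cong ab≈1 ab≈1) (*-identityˡ 1#))
    h : Matrix
    h = scale (μ * μ) (adj g)
    gh≈1 : g · h ≈ᴹ 1ᴹ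
    gh≈1 = right-inverse g (μ * μ) (trans (*-congʳ (det-similitude ν g sim)) (squares νμ≈1))
    hh′≈1 : h · scale (ν * ν) (adj h) ≈ᴹ 1ᴹ
    hh′≈1 = right-inverse h (ν * ν) (trans (*-congʳ (det-similitude μ h (similitude-inverse J g h sim νμ≈1 gh≈1)))
                                           (squares (trans (*-comm μ ν) νμ≈1)))

module MatrixMap {c₁ ℓ₁ c₂ ℓ₂} (R₁ : CommutativeRing c₁ ℓ₁) (R₂ : CommutativeRing c₂ ℓ₂)
                 {f : CommutativeRing.Carrier R₁ → CommutativeRing.Carrier R₂}
                 (isRingHomomorphism : IsRingHomomorphism (CommutativeRing.rawRing R₁) (CommutativeRing.rawRing R₂) f) where
  private
    module M₁ = Matrices R₁
    module M₂ = Matrices R₂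
  open CommutativeRing R₂ hiding (zero)
  open IsRingHomomorphism isRingHomomorphism

  map : M₁.Matrix → M₂.Matrix
  map g i j = f (g i j)

  map-· : ∀ g h → map (g M₁.· h) M₂.≈ᴹ map g M₂.· map h
  map-· g h i j = trans (+-homo _ _) (+-cong (trans (+-homo _ _) (+-cong (trans (+-homo _ _) (+-cong (*-homo _ _) (*-homo _ _))) (*-homo _ _))) (*-homo _ _))

  map-δ : ∀ {n} (i j : Fin n) → f (M₁.δ i j) ≈ M₂.δ i j
  map-δ zero    zero    = 1#-homo
  map-δ zero    (suc _) = 0#-homo
  map-δ (suc _) zero    = 0#-homo
  map-δ (suc i) (suc j) = map-δ i j

  map-1ᴹ : map M₁.1ᴹ M₂.≈ᴹ M₂.1ᴹ
  map-1ᴹ = map-δ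

  map-gram : ∀ S g → map (M₁.gram S g) M₂.≈ᴹ M₂.gram (map S) (map g)
  map-gram S g = M₂.≈ᴹ-trans (map-· (M₁.ᵀ g M₁.· S) g) (M₂.·-congʳ (map g) (map-· (M₁.ᵀ g) S))

  map-cong : ∀ {g h} → g M₁.≈ᴹ h → map g M₂.≈ᴹ map h
  map-cong g≈h i j = ⟦⟧-cong (g≈h i j)

  embed-map : ∀ {A A′ B B′} → (∀ a b → A a b ≈ f (B a b)) → (∀ a b → A′ a b ≈ f (B′ a b)) → M₂.embed A A′ M₂.≈ᴹ map (M₁.embed B B′)
  embed-map A≈ A′≈ 0F 0F = A≈ 0F 0F
  embed-map A≈ A′≈ 0F 1F = sym 0#-homo
  embed-map A≈ A′≈ 0F 2F = sym 0#-homo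
  embed-map A≈ A′≈ 0F 3F = A≈ 0F 1F
  embed-map A≈ A′≈ 1F 0F = sym 0#-homo
  embed-map A≈ A′≈ 1F 1F = A′≈ 0F 0F
  embed-map A≈ A′≈ 1F 2F = A′≈ 0F 1F
  embed-map A≈ A′≈ 1F 3F = sym 0#-homo
  embed-map A≈ A′≈ 2F 0F = sym 0#-homo
  embed-map A≈ A′≈ 2F 1F = A′≈ 1F 0F
  embed-map A≈ A′≈ 2F 2F = A′≈ 1F 1F
  embed-map A≈ A′≈ 2F 3F = sym 0#-homo
  embed-map A≈ A′≈ 3F 0F = A≈ 1F 0F
  embed-map A≈ A′≈ 3F 1F = sym 0#-homo
  embed-map A≈ A′≈ 3F 2F = sym 0#-homo
  embed-map A≈ A′≈ 3F 3F = A≈ 1F 1F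

-- R, K and O stand for ℤₚ, ℚₚ and ℤ/pᵐ, with ι the inclusion and π the reduction mod pᵐ.
module Conjugation {c₁ ℓ₁ c₂ ℓ₂ c₃ ℓ₃}
  (R : CommutativeRing c₁ ℓ₁) (K : CommutativeRing c₂ ℓ₂) (O : CommutativeRing c₃ ℓ₃)
  {ι : CommutativeRing.Carrier R → CommutativeRing.Carrier K}
  (ι-isRingMonomorphism : IsRingMonomorphism (CommutativeRing.rawRing R) (CommutativeRing.rawRing K) ι)
  {π : CommutativeRing.Carrier R → CommutativeRing.Carrier O}
  (π-isRingHomomorphism : IsRingHomomorphism (CommutativeRing.rawRing R) (CommutativeRing.rawRing O) π)
  where

  private
    module R = Matrices R
    module K = Matrices K
    module O = Matrices O
    module ιᴹ = MatrixMap R K (IsRingMonomorphism.isRingHomomorphism ι-isRingMonomorphism)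
    module πᴹ = MatrixMap R O π-isRingHomomorphism
    module ι = IsRingMonomorphism ι-isRingMonomorphism
    module π = IsRingHomomorphism π-isRingHomomorphism

  IsUnit : R.Carrier → Set (c₁ ⊔ ℓ₁)
  IsUnit x = ∃ λ u → x R.* u R.≈ R.1#

  InKlingen : R.Matrix → Set (c₁ ⊔ ℓ₁ ⊔ ℓ₃)
  InKlingen k = (∃ λ ν → IsUnit ν × R.IsSimilitude R.J ν k)
              × π (k 1F 0F) O.≈ O.0# × π (k 2F 0F) O.≈ O.0# × π (k 3F 0F) O.≈ O.0#
              × π (k 3F 1F) O.≈ O.0# × π (k 3F 2F) O.≈ O.0#

  InKHΔ : R.Matrix₂ → R.Matrix₂ → Set (c₁ ⊔ ℓ₁ ⊔ ℓ₃)
  InKHΔ B B′ = (IsUnit (R.det₂ B) × R.det₂ B R.≈ R.det₂ B′)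
             × (∃ λ x → π (B 0F 0F) O.≈ π x × π (B′ 0F 0F) O.≈ π x)
             × π (B 1F 0F) O.≈ O.0# × π (B′ 1F 0F) O.≈ O.0#

  module WithColumn {γ ν μ} (νμ≈1 : ν R.* μ R.≈ R.1#) (sim-γ : R.IsSimilitude R.J ν γ)
           (γ₀₀≈1 : γ 0F 0F R.≈ R.1#) (γ₁₀≈1 : γ 1F 0F R.≈ R.1#)
           (γ₂₀≈0 : γ 2F 0F R.≈ R.0#) (γ₃₀≈0 : γ 3F 0F R.≈ R.0#) where

    open R.Inverse (R.similitude-invertible γ sim-γ νμ≈1) renaming (g⁻¹ to γ⁻¹; inverseʳ to γγ⁻¹≈1; inverseˡ to γ⁻¹γ≈1)

    sim-γ⁻¹ : R.IsSimilitude R.J μ γ⁻¹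
    sim-γ⁻¹ = R.similitude-inverse R.J γ γ⁻¹ sim-γ νμ≈1 γγ⁻¹≈1

    column-γ : ∀ g i → (g O.· πᴹ.map γ) i 0F O.≈ g i 0F O.+ g i 1F
    column-γ g = O.·-column-e₀+e₁ g (πᴹ.map γ) 0F (O.trans (π.⟦⟧-cong γ₀₀≈1) π.1#-homo) (O.trans (π.⟦⟧-cong γ₁₀≈1) π.1#-homo)
                   (O.trans (π.⟦⟧-cong γ₂₀≈0) π.0#-homo) (O.trans (π.⟦⟧-cong γ₃₀≈0) π.0#-homo)

    forward : ∀ {A A′ k} → InKlingen k → K.embed A A′ K.· ιᴹ.map γ K.≈ᴹ ιᴹ.map γ K.· ιᴹ.map k →
              Σ R.Matrix₂ λ B → Σ R.Matrix₂ λ B′ →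
                InKHΔ B B′ × (∀ a b → A a b K.≈ ι (B a b)) × (∀ a b → A′ a b K.≈ ι (B′ a b))
    forward {A} {A′} {k} ((νₖ , (μₖ , νₖμₖ≈1) , sim-k) , k₁₀≈0 , k₂₀≈0 , k₃₀≈0 , _) eq =
      B , B′ , (((μₖ , R.trans (R.*-congʳ detB≈νₖ) νₖμₖ≈1) , R.trans detB≈νₖ (R.sym detB′≈νₖ))
               , (k 0F 0F , B₀₀≈k₀₀ , B′₀₀≈k₀₀) , B₁₀≈0 , B′₁₀≈0) , A≈ιB , A′≈ιB′
      where
      h : R.Matrix
      h = (γ R.· k) R.· γ⁻¹

      ιγ·ιγ⁻¹≈1 : ιᴹ.map γ K.· ιᴹ.map γ⁻¹ K.≈ᴹ K.1ᴹ
      ιγ·ιγ⁻¹≈1 = begin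
        ιᴹ.map γ K.· ιᴹ.map γ⁻¹   ≈⟨ ιᴹ.map-· γ γ⁻¹ ⟨
        ιᴹ.map (γ R.· γ⁻¹)        ≈⟨ ιᴹ.map-cong γγ⁻¹≈1 ⟩
        ιᴹ.map R.1ᴹ               ≈⟨ ιᴹ.map-1ᴹ ⟩
        K.1ᴹ                      ∎
        where open K.≈ᴹ-Reasoning

      embed≈ιh : K.embed A A′ K.≈ᴹ ιᴹ.map h
      embed≈ιh = begin
        K.embed A A′                                  ≈⟨ K.·-solveʳ (K.embed A A′) (ιᴹ.map γ) (ιᴹ.map γ⁻¹) _ eq ιγ·ιγ⁻¹≈1 ⟩
        (ιᴹ.map γ K.· ιᴹ.map k) K.· ιᴹ.map γ⁻¹        ≈⟨ K.·-congʳ (ιᴹ.map γ⁻¹) (ιᴹ.map-· γ k) ⟨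
        ιᴹ.map (γ R.· k) K.· ιᴹ.map γ⁻¹               ≈⟨ ιᴹ.map-· (γ R.· k) γ⁻¹ ⟨
        ιᴹ.map h                                      ∎
        where open K.≈ᴹ-Reasoning

      outer inner : Fin 2 → Fin 4
      outer 0F = 0F
      outer 1F = 3F
      inner 0F = 1F
      inner 1F = 2F

      B B′ : R.Matrix₂
      B a b = h (outer a) (outer b)
      B′ a b = h (inner a) (inner b)

      A≈ιB : ∀ a b → A a b K.≈ ι (B a b)
      A≈ιB 0F 0F = embed≈ιh 0F 0F
      A≈ιB 0F 1F = embed≈ιh 0F 3F
      A≈ιB 1F 0F = embed≈ιh 3F 0F
      A≈ιB 1F 1F = embed≈ιh 3F 3F

      A′≈ιB′ : ∀ a b → A′ a b K.≈ ι (B′ a b)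
      A′≈ιB′ 0F 0F = embed≈ιh 1F 1F
      A′≈ιB′ 0F 1F = embed≈ιh 1F 2F
      A′≈ιB′ 1F 0F = embed≈ιh 2F 1F
      A′≈ιB′ 1F 1F = embed≈ιh 2F 2F

      h≈embed : h R.≈ᴹ R.embed B B′
      h≈embed i j = ι.injective (K.trans (K.sym (embed≈ιh i j)) (ιᴹ.embed-map A≈ιB A′≈ιB′ i j))

      sim-h : R.IsSimilitude R.J νₖ h
      sim-h = R.similitude-cong R.J h multiplier
                (R.similitude-· R.J (γ R.· k) γ⁻¹ (R.similitude-· R.J γ k sim-γ sim-k) sim-γ⁻¹)
        where
        multiplier : ν R.* νₖ R.* μ R.≈ νₖ
        multiplier = R.trans (R.*-assoc ν νₖ μ) (R.trans (R.*-congˡ (R.*-comm νₖ μ))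
                       (R.trans (R.sym (R.*-assoc ν μ νₖ)) (R.trans (R.*-congʳ νμ≈1) (R.*-identityˡ νₖ))))

      sim-embed : R.IsSimilitude R.J νₖ (R.embed B B′)
      sim-embed = R.≈ᴹ-trans (R.gram-congʳ R.J (R.≈ᴹ-sym h≈embed)) sim-h

      detB≈νₖ : R.det₂ B R.≈ νₖ
      detB≈νₖ = R.trans (R.sym (R.gram-embed₀₃ B B′)) (R.trans (sim-embed 0F 3F) (R.*-identityʳ νₖ))

      detB′≈νₖ : R.det₂ B′ R.≈ νₖ
      detB′≈νₖ = R.trans (R.sym (R.gram-embed₁₂ B B′)) (R.trans (sim-embed 1F 2F) (R.*-identityʳ νₖ))

      column₀ : ∀ i → π (h i 0F) O.+ π (h i 1F) O.≈ π (γ i 0F) O.* π (k 0F 0F)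
      column₀ i = begin
        π (h i 0F) O.+ π (h i 1F)        ≈⟨ column-γ (πᴹ.map h) i ⟨
        (πᴹ.map h O.· πᴹ.map γ) i 0F      ≈⟨ πᴹ.map-· h γ i 0F ⟨
        π ((h R.· γ) i 0F)                ≈⟨ π.⟦⟧-cong (R.·-cancelʳ γ⁻¹ γ (γ R.· k) γ⁻¹γ≈1 i 0F) ⟩
        π ((γ R.· k) i 0F)                ≈⟨ πᴹ.map-· γ k i 0F ⟩
        (πᴹ.map γ O.· πᴹ.map k) i 0F      ≈⟨ O.·-column-e₀ (πᴹ.map γ) (πᴹ.map k) 0F k₁₀≈0 k₂₀≈0 k₃₀≈0 i ⟩
        π (γ i 0F) O.* π (k 0F 0F)        ∎
        where open O.≈-Reasoning

      πh≈0 : ∀ i j → h i j R.≈ R.0# → π (h i j) O.≈ O.0#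
      πh≈0 i j hᵢⱼ≈0 = O.trans (π.⟦⟧-cong hᵢⱼ≈0) π.0#-homo

      γ-entry≈1 : ∀ {a} x → γ a 0F R.≈ R.1# → π (γ a 0F) O.* x O.≈ x
      γ-entry≈1 x γₐ₀≈1 = O.trans (O.*-congʳ (O.trans (π.⟦⟧-cong γₐ₀≈1) π.1#-homo)) (O.*-identityˡ x)

      γ-entry≈0 : ∀ {a} x → γ a 0F R.≈ R.0# → π (γ a 0F) O.* x O.≈ O.0#
      γ-entry≈0 x γₐ₀≈0 = O.*-zeroˡ-≈ x (O.trans (π.⟦⟧-cong γₐ₀≈0) π.0#-homo)

      B₀₀≈k₀₀ : π (B 0F 0F) O.≈ π (k 0F 0F)
      B₀₀≈k₀₀ = O.drop-zeroʳ (πh≈0 0F 1F (h≈embed 0F 1F)) (O.trans (column₀ 0F) (γ-entry≈1 _ γ₀₀≈1))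

      B′₀₀≈k₀₀ : π (B′ 0F 0F) O.≈ π (k 0F 0F)
      B′₀₀≈k₀₀ = O.drop-zeroˡ (πh≈0 1F 0F (h≈embed 1F 0F)) (O.trans (column₀ 1F) (γ-entry≈1 _ γ₁₀≈1))

      B′₁₀≈0 : π (B′ 1F 0F) O.≈ O.0#
      B′₁₀≈0 = O.drop-zeroˡ (πh≈0 2F 0F (h≈embed 2F 0F)) (O.trans (column₀ 2F) (γ-entry≈0 _ γ₂₀≈0))

      B₁₀≈0 : π (B 1F 0F) O.≈ O.0#
      B₁₀≈0 = O.drop-zeroʳ (πh≈0 3F 1F (h≈embed 3F 1F)) (O.trans (column₀ 3F) (γ-entry≈0 _ γ₃₀≈0))

    backward : ∀ {A A′ B B′} → InKHΔ B B′ → (∀ a b → A a b K.≈ ι (B a b)) → (∀ a b → A′ a b K.≈ ι (B′ a b)) →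
               Σ R.Matrix λ k → InKlingen k × (K.embed A A′ K.· ιᴹ.map γ K.≈ᴹ ιᴹ.map γ K.· ιᴹ.map k)
    backward {A} {A′} {B} {B′} (((y , dy≈1) , d≈d′) , (x , B₀₀≈x , B′₀₀≈x) , B₁₀≈0 , B′₁₀≈0) A≈ιB A′≈ιB′ =
      k , ((d , (y , dy≈1) , sim-k) , k₁₀≈0 , k₂₀≈0 , k₃₀≈0 , k₃₁≈0 , k₃₂≈0) , eq
      where
      d : R.Carrier
      d = R.det₂ B

      h : R.Matrix
      h = R.embed B B′

      k : R.Matrix
      k = γ⁻¹ R.· (h R.· γ)

      sim-k : R.IsSimilitude R.J d k
      sim-k = R.similitude-cong R.J k multiplier
                (R.similitude-· R.J γ⁻¹ (h R.· γ) sim-γ⁻¹ (R.similitude-· R.J h γ (R.embed-similitude B B′ d≈d′) sim-γ))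
        where
        multiplier : μ R.* (d R.* ν) R.≈ d
        multiplier = R.trans (R.*-congˡ (R.*-comm d ν)) (R.trans (R.sym (R.*-assoc μ ν d))
                       (R.trans (R.*-congʳ (R.trans (R.*-comm μ ν) νμ≈1)) (R.*-identityˡ d)))

      eq : K.embed A A′ K.· ιᴹ.map γ K.≈ᴹ ιᴹ.map γ K.· ιᴹ.map k
      eq = begin
        K.embed A A′ K.· ιᴹ.map γ       ≈⟨ K.·-congʳ (ιᴹ.map γ) (ιᴹ.embed-map A≈ιB A′≈ιB′) ⟩
        ιᴹ.map h K.· ιᴹ.map γ           ≈⟨ ιᴹ.map-· h γ ⟨
        ιᴹ.map (h R.· γ)                ≈⟨ ιᴹ.map-cong (R.·-cancelˡ γ γ⁻¹ (h R.· γ) γγ⁻¹≈1) ⟨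
        ιᴹ.map (γ R.· k)                ≈⟨ ιᴹ.map-· γ k ⟩
        ιᴹ.map γ K.· ιᴹ.map k           ∎
        where open K.≈ᴹ-Reasoning

      hγ-column : ∀ a → π ((h R.· γ) a 0F) O.≈ π x O.* π (γ a 0F)
      hγ-column a = O.trans (πᴹ.map-· h γ a 0F) (O.trans (column-γ (πᴹ.map h) a) (entries a))
        where
        x·1 : ∀ {a} → γ a 0F R.≈ R.1# → π x O.≈ π x O.* π (γ a 0F)
        x·1 γₐ₀≈1 = O.sym (O.trans (O.*-congˡ (O.trans (π.⟦⟧-cong γₐ₀≈1) π.1#-homo)) (O.*-identityʳ (π x)))
        x·0 : ∀ {a} → γ a 0F R.≈ R.0# → O.0# O.≈ π x O.* π (γ a 0F)
        x·0 γₐ₀≈0 = O.sym (O.*-zeroʳ-≈ (π x) (O.trans (π.⟦⟧-cong γₐ₀≈0) π.0#-homo))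
        entries : ∀ a → π (h a 0F) O.+ π (h a 1F) O.≈ π x O.* π (γ a 0F)
        entries 0F = O.trans (O.+-congˡ π.0#-homo) (O.trans (O.+-identityʳ _) (O.trans B₀₀≈x (x·1 γ₀₀≈1)))
        entries 1F = O.trans (O.+-congʳ π.0#-homo) (O.trans (O.+-identityˡ _) (O.trans B′₀₀≈x (x·1 γ₁₀≈1)))
        entries 2F = O.trans (O.+-congʳ π.0#-homo) (O.trans (O.+-identityˡ _) (O.trans B′₁₀≈0 (x·0 γ₂₀≈0)))
        entries 3F = O.trans (O.+-congˡ π.0#-homo) (O.trans (O.+-identityʳ _) (O.trans B₁₀≈0 (x·0 γ₃₀≈0)))

      k-column : ∀ i → π (k i 0F) O.≈ π x O.* π (R.1ᴹ i 0F)
      k-column i = begin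
        π (k i 0F)                                ≈⟨ πᴹ.map-· γ⁻¹ (h R.· γ) i 0F ⟩
        (πᴹ.map γ⁻¹ O.· πᴹ.map (h R.· γ)) i 0F    ≈⟨ O.·-column-scaled (πᴹ.map γ⁻¹) (πᴹ.map (h R.· γ)) (πᴹ.map γ) (π x) 0F hγ-column i ⟩
        π x O.* (πᴹ.map γ⁻¹ O.· πᴹ.map γ) i 0F    ≈⟨ O.*-congˡ (πᴹ.map-· γ⁻¹ γ i 0F) ⟨
        π x O.* π ((γ⁻¹ R.· γ) i 0F)              ≈⟨ O.*-congˡ (π.⟦⟧-cong (γ⁻¹γ≈1 i 0F)) ⟩
        π x O.* π (R.1ᴹ i 0F)                     ∎
        where open O.≈-Reasoning

      k₁₀≈0 : π (k 1F 0F) O.≈ O.0#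
      k₁₀≈0 = O.trans (k-column 1F) (O.*-zeroʳ-≈ (π x) π.0#-homo)
      k₂₀≈0 : π (k 2F 0F) O.≈ O.0#
      k₂₀≈0 = O.trans (k-column 2F) (O.*-zeroʳ-≈ (π x) π.0#-homo)
      k₃₀≈0 : π (k 3F 0F) O.≈ O.0#
      k₃₀≈0 = O.trans (k-column 3F) (O.*-zeroʳ-≈ (π x) π.0#-homo)

      J₀≈e₃ : ∀ b → π (R.J 0F b) O.≈ O.δ 3F b
      J₀≈e₃ 0F = π.0#-homo
      J₀≈e₃ 1F = π.0#-homo
      J₀≈e₃ 2F = π.0#-homo
      J₀≈e₃ 3F = π.1#-homo

      row₃ : ∀ j → π (k 0F 0F) O.* π (k 3F j) O.≈ π d O.* π (R.J 0F j)
      row₃ j = begin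
        π (k 0F 0F) O.* π (k 3F j)             ≈⟨ O.gram-row₀ (πᴹ.map R.J) (πᴹ.map k) J₀≈e₃ k₁₀≈0 k₂₀≈0 k₃₀≈0 j ⟨
        O.gram (πᴹ.map R.J) (πᴹ.map k) 0F j    ≈⟨ πᴹ.map-gram R.J k 0F j ⟨
        π (R.gram R.J k 0F j)                  ≈⟨ π.⟦⟧-cong (sim-k 0F j) ⟩
        π (d R.* R.J 0F j)                     ≈⟨ π.*-homo d (R.J 0F j) ⟩
        π d O.* π (R.J 0F j)                   ∎
        where open O.≈-Reasoning

      k₀₀-unit : π (k 0F 0F) O.* (π (k 3F 3F) O.* π y) O.≈ O.1#
      k₀₀-unit = begin
        π (k 0F 0F) O.* (π (k 3F 3F) O.* π y)   ≈⟨ O.*-assoc _ _ _ ⟨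
        π (k 0F 0F) O.* π (k 3F 3F) O.* π y     ≈⟨ O.*-congʳ (O.trans (row₃ 3F) (O.*-congˡ π.1#-homo)) ⟩
        π d O.* O.1# O.* π y                    ≈⟨ O.*-congʳ (O.*-identityʳ (π d)) ⟩
        π d O.* π y                             ≈⟨ π.*-homo d y ⟨
        π (d R.* y)                             ≈⟨ O.trans (π.⟦⟧-cong dy≈1) π.1#-homo ⟩
        O.1#                                    ∎
        where open O.≈-Reasoning

      k₃₁≈0 : π (k 3F 1F) O.≈ O.0#
      k₃₁≈0 = O.annihilated-by-unit k₀₀-unit (O.trans (row₃ 1F) (O.*-zeroʳ-≈ (π d) π.0#-homo))
      k₃₂≈0 : π (k 3F 2F) O.≈ O.0#
      k₃₂≈0 = O.annihilated-by-unit k₀₀-unit (O.trans (row₃ 2F) (O.*-zeroʳ-≈ (π d) π.0#-homo))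

module Proposition (p : ℕ) .{{_ : NonZero p}} (m : ℕ) where
  open Padic p
  open PadicIntegers p
  open PadicNumbers p
  module Zₚ = Matrices ℤₚ
  module Qₚ = Matrices ℚₚ

  ℤ/p^m : CommutativeRing _ _
  ℤ/p^m = IntegersModulo.commutativeRing (P m)

  π : Zp → ℤ
  π x = r x m

  π-isRingHomomorphism : IsRingHomomorphism (CommutativeRing.rawRing ℤₚ) (CommutativeRing.rawRing ℤ/p^m) π
  π-isRingHomomorphism = record
    { isSemiringHomomorphism = record
      { isNearSemiringHomomorphism = record
        { +-isMonoidHomomorphism = record
          { isMagmaHomomorphism = record
            { isRelHomomorphism = record { cong = λ x≈y → x≈y m } ; homo = λ x y → ≈ₘ-refl (π (x +ᶻ y)) }
          ; ε-homo = ≈ₘ-refl (π 0ᶻ) }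
        ; *-homo = λ x y → ≈ₘ-refl (π (x *ᶻ y)) }
      ; 1#-homo = ≈ₘ-refl (π 1ᶻ) }
    ; -‿homo = λ x → ≈ₘ-refl (π (-ᶻ x)) }
    where
    ≈ₘ-refl : ∀ a → P m ∣ a ℤ.- a
    ≈ₘ-refl a = IntegersModulo.≈ₖ-refl (P m) {a}

  open Conjugation ℤₚ ℚₚ ℤ/p^m ι-isRingMonomorphism π-isRingHomomorphism

  J≡J : ∀ i j → J i j ≡ Zₚ.J i j
  J≡J 0F 0F = ≡.refl
  J≡J 0F 1F = ≡.refl
  J≡J 0F 2F = ≡.refl
  J≡J 0F 3F = ≡.refl
  J≡J 1F 0F = ≡.refl
  J≡J 1F 1F = ≡.refl
  J≡J 1F 2F = ≡.refl
  J≡J 1F 3F = ≡.refl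
  J≡J 2F 0F = ≡.refl
  J≡J 2F 1F = ≡.refl
  J≡J 2F 2F = ≡.refl
  J≡J 2F 3F = ≡.refl
  J≡J 3F 0F = ≡.refl
  J≡J 3F 1F = ≡.refl
  J≡J 3F 2F = ≡.refl
  J≡J 3F 3F = ≡.refl

  embH≡embed : ∀ A A′ i j → embH A A′ i j ≡ Qₚ.embed A A′ i j
  embH≡embed A A′ 0F 0F = ≡.refl
  embH≡embed A A′ 0F 1F = ≡.refl
  embH≡embed A A′ 0F 2F = ≡.refl
  embH≡embed A A′ 0F 3F = ≡.refl
  embH≡embed A A′ 1F 0F = ≡.refl
  embH≡embed A A′ 1F 1F = ≡.refl
  embH≡embed A A′ 1F 2F = ≡.refl
  embH≡embed A A′ 1F 3F = ≡.refl
  embH≡embed A A′ 2F 0F = ≡.refl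
  embH≡embed A A′ 2F 1F = ≡.refl
  embH≡embed A A′ 2F 2F = ≡.refl
  embH≡embed A A′ 2F 3F = ≡.refl
  embH≡embed A A′ 3F 0F = ≡.refl
  embH≡embed A A′ 3F 1F = ≡.refl
  embH≡embed A A′ 3F 2F = ≡.refl
  embH≡embed A A′ 3F 3F = ≡.refl

  J≈J : J Zₚ.≈ᴹ Zₚ.J
  J≈J i j = Zₚ.reflexive (J≡J i j)

  similitude⁺ : ∀ ν g → (transpose g ·ᶻ J) ·ᶻ g ≈M scal ν J → Zₚ.IsSimilitude Zₚ.J ν g
  similitude⁺ ν g sim = begin
    Zₚ.gram Zₚ.J g   ≈⟨ Zₚ.gram-congˡ g {J} {Zₚ.J} J≈J ⟨
    Zₚ.gram J g      ≈⟨ sim ⟩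
    Zₚ.scale ν J     ≈⟨ Zₚ.scale-congʳ ν {J} {Zₚ.J} J≈J ⟩
    Zₚ.scale ν Zₚ.J  ∎
    where open Zₚ.≈ᴹ-Reasoning

  similitude⁻ : ∀ ν g → Zₚ.IsSimilitude Zₚ.J ν g → (transpose g ·ᶻ J) ·ᶻ g ≈M scal ν J
  similitude⁻ ν g sim = begin
    Zₚ.gram J g      ≈⟨ Zₚ.gram-congˡ g {J} {Zₚ.J} J≈J ⟩
    Zₚ.gram Zₚ.J g   ≈⟨ sim ⟩
    Zₚ.scale ν Zₚ.J  ≈⟨ Zₚ.scale-congʳ ν {J} {Zₚ.J} J≈J ⟨
    Zₚ.scale ν J     ∎
    where open Zₚ.≈ᴹ-Reasoning

  embH·≈embed· : ∀ A A′ g → embH A A′ Qₚ.· g Qₚ.≈ᴹ Qₚ.embed A A′ Qₚ.· g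
  embH·≈embed· A A′ g = Qₚ.·-congʳ g {embH A A′} {Qₚ.embed A A′} λ i j → Qₚ.reflexive (embH≡embed A A′ i j)

  theorem : (γ : Mat 4 Zp) → InGZp γ →
    γ f0 f0 ≈ 1ᶻ → γ f1 f0 ≈ 1ᶻ → γ f2 f0 ≈ 0ᶻ → γ f3 f0 ≈ 0ᶻ →
    (A A′ : Mat 2 Qp) → InConjKl m γ A A′ ⇔ InKHΔQ m A A′
  theorem γ (ν , (μ , νμ≈1) , sim-γ) γ₀₀≈1 γ₁₀≈1 γ₂₀≈0 γ₃₀≈0 A A′ = mk⇔ to from
    where
    module Γ = WithColumn {γ} {ν} {μ} νμ≈1 (similitude⁺ ν γ sim-γ) γ₀₀≈1 γ₁₀≈1 γ₂₀≈0 γ₃₀≈0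

    to : InConjKl m γ A A′ → InKHΔQ m A A′
    to (k , ((νₖ , unit , sim-k) , k-conditions) , eq) =
      Γ.forward {A} {A′} {k} ((νₖ , unit , similitude⁺ νₖ k sim-k) , k-conditions) (begin
        Qₚ.embed A A′ Qₚ.· ιM γ  ≈⟨ embH·≈embed· A A′ (ιM γ) ⟨
        embH A A′ Qₚ.· ιM γ      ≈⟨ eq ⟩
        ιM γ Qₚ.· ιM k           ∎)
      where open Qₚ.≈ᴹ-Reasoning

    from : InKHΔQ m A A′ → InConjKl m γ A A′
    from (B , B′ , B-conditions , A≈ιB , A′≈ιB′) =
      let k , ((d , unit , sim-k) , k-conditions) , eq = Γ.backward {A} {A′} {B} {B′} B-conditions A≈ιB A′≈ιB′
      in k , ((d , unit , similitude⁻ d k sim-k) , k-conditions) , (begin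
        embH A A′ Qₚ.· ιM γ      ≈⟨ embH·≈embed· A A′ (ιM γ) ⟩
        Qₚ.embed A A′ Qₚ.· ιM γ  ≈⟨ eq ⟩
        ιM γ Qₚ.· ιM k           ∎)
      where open Qₚ.≈ᴹ-Reasoning

-- Primality is only used through p ≢ 0.
proposition4p1 : (p : ℕ) → Prime p → (m : ℕ) → 1 ≤ m →
    let open Padic p in
    (γ : Mat 4 Zp) → InGZp γ →
    γ f0 f0 ≈ 1ᶻ → γ f1 f0 ≈ 1ᶻ → γ f2 f0 ≈ 0ᶻ → γ f3 f0 ≈ 0ᶻ →
    (A A' : Mat 2 Qp) → InHQp A A' →
    (InConjKl m γ A A' ⇔ InKHΔQ m A A')
proposition4p1 p p-prime m _ γ γ∈G γ₀₀≈1 γ₁₀≈1 γ₂₀≈0 γ₃₀≈0 A A′ _ =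
  Proposition.theorem p {{prime⇒nonZero p-prime}} m γ γ∈G γ₀₀≈1 γ₁₀≈1 γ₂₀≈0 γ₃₀≈0 A A′
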